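{- Let $M=\prod_{i=1}^Kp_i^{n_i}$. (i) Suppose $A,B\subset\mathbb{Z}_M$ and $A\oplus B=\mathbb{Z}_M$. Then for every $N\mid M$ and all $x,y\in\mathbb{Z}_M$, $$\langle\mathbb{A}^N[x],\mathbb{B}^N[y]\rangle=\frac{|A||B|}{N}=\frac{M}{N};$$ in particular $\langle\mathbb{A}^M[x],\mathbb{B}^M[y]\rangle=1$ for all $x,y\in\mathbb{Z}_M$. (ii) Conversely, if $A,B\subset\mathbb{Z}_M$ are sets with $|A||B|=M$ and $\langle\mathbb{A}^M[a],\mathbb{B}^M[b]\rangle=1$ for all $a\in A$, $b\in B$, then $A\oplus B=\mathbb{Z}_M$.
   Context: $p_1,\dots,p_K$ are distinct primes, $n_i\ge1$. $A\oplus B=\mathbb{Z}_M$ means every element of $\mathbb{Z}_M$ is uniquely $a+b$, $a\in A,b\in B$. For $N\mid M$, an $N$-box is a real array $\mathbb{A}=(\mathbb{A}_m)_{m\mid N}$ indexed by divisors of $N$; the box product of two $N$-boxes is $\langle\mathbb{A},\mathbb{B}\rangle=\sum_{m\mid N}\frac{1}{\phi(N/m)}\mathbb{A}_m\mathbb{B}_m$, $\phi$ Euler's totient. For $A\subset\mathbb{Z}_M$ and $N\mid M$, let $w_A^N(z)=\#\{a\in A:a\equiv z\bmod N\}$ for $z\in\mathbb{Z}_N$, and for $x\in\mathbb{Z}_M$ define the $N$-box $\mathbb{A}^N[x]$ by $\mathbb{A}^N_m[x]=\sum_{z\in\mathbb{Z}_N:\gcd(x-z,N)=m}w_A^N(z)$;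 in particular $\mathbb{A}^M_m[x]=\#\{a\in A:\gcd(x-a,M)=m\}$. Similarly for $B$. -}

module Defs where

open import Data.Nat using (ℕ; zero; suc; _+_; _*_; _∸_; _^_; _≟_)
open import Data.Nat.DivMod using (_%_; _/_)
open import Data.Nat.GCD using (gcd)
open import Data.Nat.Divisibility using (_∣_; _∣?_)
open import Data.List using (List; []; _∷_; map; filter; length; upTo)
open import Data.Nat.ListAction using (sum)
open import Data.Fin using (Fin; toℕ)
open import Data.Fin.Subset using (Subset; _∈_; ∣_∣)
open import Data.Fin.Subset.Properties using (_∈?_)
open import Data.Fin.Base using (zero; suc)
open import Data.Product using (_×_; Σ; ∃; ∃-syntax; _,_)
open import Data.Integer using (+_)
open import Relation.Binary.PropositionalEquality using (_≡_)
import Data.Rational as ℚ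
open ℚ using (ℚ)
import Data.List.Base as L

prodFin : ∀ {K} → (Fin K → ℕ) → ℕ
prodFin {zero}  f = 1
prodFin {suc K} f = f zero * prodFin (λ i → f (suc i))

modulus : ∀ {K} → (Fin K → ℕ) → (Fin K → ℕ) → ℕ
modulus ps ns = prodFin (λ i → ps i ^ ns i)

-- total reduction mod N (N ≥ 1 in every use; the zero case is never used)
modℕ : ℕ → ℕ → ℕ
modℕ x zero    = x
modℕ x (suc n) = x % suc n

φ : ℕ → ℕ
φ n = length (filter (λ k → gcd k n ≟ 1) (map suc (upTo n)))

divisors : ℕ → List ℕ
divisors N = filter (λ m → m ∣? N) (map suc (upTo N))

-- a / d as a rational (d = 0 never occurs in our uses)
frac : ℕ → ℕ → ℚ
frac a zero    = ℚ.0ℚ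
frac a (suc d) = (+ a) ℚ./ suc d

-- quotient N / m (m ≥ 1 in every use)
quot : ℕ → ℕ → ℕ
quot N zero    = 0
quot N (suc m) = N / suc m

-- An N-box is an array indexed by divisors of N; we represent it as ℕ → ℕ
-- and only ever read it at divisors of N.
Box : Set
Box = ℕ → ℕ

boxProduct : ℕ → Box → Box → ℚ
boxProduct N 𝔸 𝔹 = L.foldr ℚ._+_ ℚ.0ℚ
  (map (λ m → frac (𝔸 m * 𝔹 m) (φ (quot N m))) (divisors N))

countIn : ∀ {M} → Subset M → (Fin M → ℕ) → ℕ → ℕ
countIn {M} A f z =
  length (filter (λ a → f a ≟ z) (filter (λ a → a ∈? A) (Data.List.allFin M)))
  where import Data.List

w : ∀ {M} → Subset M → ℕ → ℕ → ℕ
w A N z = countIn A (λ a → modℕ (toℕ a) N) z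

-- (x - z) mod N, for x ∈ ℤ_M (given by its representative) and z ∈ ℤ_N
diffMod : ℕ → ℕ → ℕ → ℕ
diffMod N x z = modℕ (modℕ x N + N ∸ z) N

boxOf : ∀ {M} → Subset M → (N : ℕ) → Fin M → Box
boxOf A N x m =
  sum (map (w A N) (filter (λ z → gcd (diffMod N (toℕ x) z) N ≟ m) (upTo N)))

SumsTo : ∀ {M} → Fin M → Fin M → Fin M → Set
SumsTo {M} a b c = modℕ (toℕ a + toℕ b) M ≡ toℕ c

DirectSum : ∀ {M} → Subset M → Subset M → Set
DirectSum {M} A B =
  ((c : Fin M) → ∃[ a ] ∃[ b ] (a ∈ A × b ∈ B × SumsTo a b c))
  × (∀ {a b a′ b′ : Fin M} → a ∈ A → b ∈ B → a′ ∈ A → b′ ∈ B →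
       modℕ (toℕ a + toℕ b) M ≡ modℕ (toℕ a′ + toℕ b′) M → a ≡ a′ × b ≡ b′)

-- For a unit h of ℤ_M and N ∣ M, count the pairs (a , b) ∈ A × B with h (y - b) ≡ x - a (mod N).
-- Such a pair forces gcd(x - a, N) = gcd(y - b, N) = c, and exactly φ(M) / φ(N / c) units h solve
-- the congruence, so φ(M) ⟨𝔸^N[x], 𝔹^N[y]⟩ is the total count over all units h of ℤ_M.
-- If A ⊕ B = ℤ_M then A ⊕ h·B = ℤ_M for every unit h (Tijdeman's dilation theorem, proved one prime
-- q ∤ |B| at a time from the Frobenius congruence (Σ_b X^b)^q ≡ Σ_b X^(q b) mod q), so each count is
-- M / N and the box product is M / N.  Conversely, if the box product at (a , b) ∈ A × B is 1, every
-- count is 1; for h = -1 this says that a + b has no other representation, and |A| |B| = M then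
-- forces A ⊕ B = ℤ_M.
module Submission where

open import Defs
open import Data.Nat using (ℕ; _*_; _≤_)
open import Data.Nat.Divisibility using (_∣_)
open import Data.Nat.Primality using (Prime)
open import Data.Fin using (Fin)
open import Data.Fin.Subset using (Subset; _∈_; ∣_∣)
open import Data.Product using (_×_)
open import Relation.Binary.PropositionalEquality using (_≡_)
open import Data.Rational using (1ℚ)

open import Algebra.Bundles using (Semiring)
open import Data.Empty using (⊥; ⊥-elim)
open import Data.Fin using (toℕ; fromℕ<)
import Data.Fin as Fin
open import Data.Fin.Properties using (toℕ-fromℕ<; toℕ<n; toℕ-injective)
open import Data.Fin.Subset using (inside; outside)
open import Data.Fin.Subset.Properties using (_∈?_; drop-there)
open import Data.List using (List; []; _∷_; filter; map; _++_; replicate; length; applyUpTo; upTo; allFin; tabulate; foldr)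
open import Data.List.Membership.Propositional.Properties using (∈-filter⁺; ∈-filter⁻)
open import Data.List.Properties using (map-∘)
open import Data.List.Relation.Unary.All using ([]; _∷_)
import Data.List.Relation.Unary.All.Properties as All
open import Data.Nat
open import Data.Nat.Combinatorics using (_C_; nCk≡n!/k![n-k]!; k![n∸k]!∣n!; nCn≡1)
open import Data.Nat.Coprimality using (Coprime; coprime-divisor; gcd≡1⇒coprime; coprime-Bézout)
open import Data.Nat.DivMod
open import Data.Nat.Divisibility
open import Data.Nat.GCD
open import Data.Nat.Induction using (<-rec)
open import Data.Nat.ListAction using (sum; product)
open import Data.Nat.ListAction.Properties using (∈⇒∣product)
open import Data.Nat.Primality
open import Data.Nat.Primality.Factorisation using (factorise; PrimeFactorisation; factorisationHasAllPrimeFactors)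
open import Data.Nat.Properties
open import Algebra.Properties.Semiring.Sum +-*-semiring using (∑-comm; ∑-distrib-+; *-distribˡ-sum) renaming (sum to sumᵥ)
open import Data.Nat.Tactic.RingSolver using (solve-∀)
open import Data.Product using (∃-syntax; _,_; proj₁; proj₂)
open import Data.Rational using (ℚ; 0ℚ) renaming (_+_ to _ℚ+_)
import Data.Rational as ℚ
import Data.Rational.Properties as ℚ
open import Data.Rational.Unnormalised using (mkℚᵘ; *≡*)
import Data.Rational.Unnormalised.Properties as ℚᵘ
open import Data.Sum using (inj₁; inj₂)
open import Data.Vec using (_∷_; []; there)
open import Function using (_∘_; case_of_)
open import Level using (0ℓ)
open import Relation.Binary.PropositionalEquality
open import Relation.Binary.Structures using (IsEquivalence)
open import Relation.Nullary using (¬_; ¬?; Dec; yes; no)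

Σ< : ℕ → (ℕ → ℕ) → ℕ
Σ< n f = sumᵥ {n} (λ i → f (toℕ i))

𝟙 : ∀ {p} {P : Set p} → Dec P → ℕ
𝟙 (yes _) = 1
𝟙 (no _)  = 0

module _ {p} {P : Set p} where

  𝟙-yes : (d : Dec P) → P → 𝟙 d ≡ 1
  𝟙-yes (yes _) _  = refl
  𝟙-yes (no ¬p) p = ⊥-elim (¬p p)

  𝟙-no : (d : Dec P) → ¬ P → 𝟙 d ≡ 0
  𝟙-no (yes p) ¬p = ⊥-elim (¬p p)
  𝟙-no (no _) _   = refl

  𝟙-pos : (d : Dec P) → 1 ≤ 𝟙 d → P
  𝟙-pos (yes p) _ = p

  𝟙-cong : ∀ {q} {Q : Set q} (d : Dec P) (e : Dec Q) → (P → Q) → (Q → P) → 𝟙 d ≡ 𝟙 e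
  𝟙-cong (yes p) (yes q) _ _ = refl
  𝟙-cong (yes p) (no ¬q) f _ = ⊥-elim (¬q (f p))
  𝟙-cong (no ¬p) (yes q) _ g = ⊥-elim (¬p (g q))
  𝟙-cong (no ¬p) (no ¬q) _ _ = refl

*-annihilate : ∀ x y → (1 ≤ x → y ≡ 0) → x * y ≡ 0
*-annihilate zero    y _ = refl
*-annihilate (suc x) y h rewrite h (s≤s z≤n) = *-zeroʳ (suc x)

Σ<-cong : ∀ n {f g : ℕ → ℕ} → (∀ k → k < n → f k ≡ g k) → Σ< n f ≡ Σ< n g
Σ<-cong zero    h = refl
Σ<-cong (suc n) h = cong₂ _+_ (h 0 (s≤s z≤n)) (Σ<-cong n (λ k k<n → h (suc k) (s≤s k<n)))

Σ<-ext : ∀ n {f g : ℕ → ℕ} → (∀ k → f k ≡ g k) → Σ< n f ≡ Σ< n g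
Σ<-ext n h = Σ<-cong n (λ k _ → h k)

Σ<-distrib-+ : ∀ n (f g : ℕ → ℕ) → Σ< n (λ k → f k + g k) ≡ Σ< n f + Σ< n g
Σ<-distrib-+ n f g = ∑-distrib-+ {n} (λ i → f (toℕ i)) (λ i → g (toℕ i))

Σ<-*ˡ : ∀ n c (f : ℕ → ℕ) → Σ< n (λ k → c * f k) ≡ c * Σ< n f
Σ<-*ˡ n c f = sym (*-distribˡ-sum {n} c (λ i → f (toℕ i)))

Σ<-*ʳ : ∀ n c (f : ℕ → ℕ) → Σ< n (λ k → f k * c) ≡ Σ< n f * c
Σ<-*ʳ n c f = trans (Σ<-ext n (λ k → *-comm (f k) c)) (trans (Σ<-*ˡ n c f) (*-comm c _))

Σ<-comm : ∀ n m (f : ℕ → ℕ → ℕ) → Σ< n (λ i → Σ< m (f i)) ≡ Σ< m (λ j → Σ< n (λ i → f i j))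
Σ<-comm n m f = ∑-comm {n} {m} (λ i j → f (toℕ i) (toℕ j))

Σ<-zero : ∀ n {f : ℕ → ℕ} → (∀ k → k < n → f k ≡ 0) → Σ< n f ≡ 0
Σ<-zero zero    h = refl
Σ<-zero (suc n) h rewrite h 0 (s≤s z≤n) = Σ<-zero n (λ k k<n → h (suc k) (s≤s k<n))

Σ<-const : ∀ n c → Σ< n (λ _ → c) ≡ n * c
Σ<-const zero    c = refl
Σ<-const (suc n) c = cong (c +_) (Σ<-const n c)

Σ<-init-last : ∀ n (f : ℕ → ℕ) → Σ< (suc n) f ≡ Σ< n f + f n
Σ<-init-last zero    f = +-identityʳ (f 0)
Σ<-init-last (suc n) f rewrite Σ<-init-last n (λ k → f (suc k)) = sym (+-assoc (f 0) _ _)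

Σ<-single : ∀ n c {f : ℕ → ℕ} → c < n → (∀ k → k < n → k ≢ c → f k ≡ 0) → Σ< n f ≡ f c
Σ<-single (suc n) zero {f} _ h =
  trans (cong (f 0 +_) (Σ<-zero n (λ k k<n → h (suc k) (s≤s k<n) λ ()))) (+-identityʳ (f 0))
Σ<-single (suc n) (suc c) {f} (s≤s c<n) h =
  trans (cong (_+ Σ< n (λ k → f (suc k))) (h 0 (s≤s z≤n) λ ()))
        (Σ<-single n c c<n (λ k k<n k≢c → h (suc k) (s≤s k<n) (k≢c ∘ suc-injective)))

Σ<-delta : ∀ n c (f : ℕ → ℕ) → c < n → Σ< n (λ k → 𝟙 (c ≟ k) * f k) ≡ f c
Σ<-delta n c f c<n =
  trans (Σ<-single n c c<n (λ k _ k≢c → cong (_* f k) (𝟙-no (c ≟ k) (k≢c ∘ sym))))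
        (trans (cong (_* f c) (𝟙-yes (c ≟ c) refl)) (+-identityʳ (f c)))

Σ<-𝟙-unique : ∀ n c {P : ℕ → Set} (P? : ∀ k → Dec (P k)) → c < n → P c →
  (∀ k → k < n → P k → k ≡ c) → Σ< n (λ k → 𝟙 (P? k)) ≡ 1
Σ<-𝟙-unique n c P? c<n Pc unique =
  trans (Σ<-single n c c<n (λ k k<n k≢c → 𝟙-no (P? k) (λ Pk → k≢c (unique k k<n Pk)))) (𝟙-yes (P? c) Pc)

Σ<-mono : ∀ n {f g : ℕ → ℕ} → (∀ k → k < n → f k ≤ g k) → Σ< n f ≤ Σ< n g
Σ<-mono zero    h = z≤n
Σ<-mono (suc n) h = +-mono-≤ (h 0 (s≤s z≤n)) (Σ<-mono n (λ k k<n → h (suc k) (s≤s k<n)))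

term≤Σ< : ∀ n c (f : ℕ → ℕ) → c < n → f c ≤ Σ< n f
term≤Σ< (suc n) zero    f _         = m≤m+n (f 0) _
term≤Σ< (suc n) (suc c) f (s≤s c<n) = ≤-trans (term≤Σ< n c (λ k → f (suc k)) c<n) (m≤n+m _ (f 0))

Σ<-pos : ∀ n (f : ℕ → ℕ) → 1 ≤ Σ< n f → ∃[ k ] (k < n × 1 ≤ f k)
Σ<-pos (suc n) f h with f 0 in e
... | suc _ = 0 , s≤s z≤n , subst (1 ≤_) (sym e) (s≤s z≤n)
... | zero  with Σ<-pos n (λ k → f (suc k)) h
...   | k , k<n , fk = suc k , s≤s k<n , fk

Σ<-tight : ∀ n {f g : ℕ → ℕ} → (∀ k → k < n → f k ≤ g k) → Σ< n f ≡ Σ< n g →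
  ∀ k → k < n → f k ≡ g k
Σ<-tight (suc n) {f} {g} f≤g e k k<n = case k k<n
  where
  f≤g′ : ∀ k → k < n → f (suc k) ≤ g (suc k)
  f≤g′ k k<n = f≤g (suc k) (s≤s k<n)
  head : f 0 ≡ g 0
  head = ≤-antisym (f≤g 0 (s≤s z≤n)) (+-cancelʳ-≤ (Σ< n (λ k → g (suc k))) (g 0) (f 0)
    (≤-trans (≤-reflexive (sym e)) (+-monoʳ-≤ (f 0) (Σ<-mono n f≤g′))))
  case : ∀ k → k < suc n → f k ≡ g k
  case zero    _         = head
  case (suc k) (s≤s k<n) =
    Σ<-tight n f≤g′ (+-cancelˡ-≡ (f 0) _ _ (trans e (cong (_+ _) (sym head)))) k k<n

Σ<≡1⇒unique : ∀ n (f : ℕ → ℕ) → Σ< n f ≡ 1 → ∀ i j → i < n → j < n → 1 ≤ f i → 1 ≤ f j → i ≡ j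
Σ<≡1⇒unique n f e i j i<n j<n fi fj with i ≟ j
... | yes i≡j = i≡j
... | no  i≢j = ⊥-elim (<-irrefl refl (≤-trans two (≤-reflexive e)))
  where
  δ : ℕ → ℕ → ℕ
  δ c k = 𝟙 (c ≟ k) * 1
  le : ∀ k → k < n → δ i k + δ j k ≤ f k
  le k _ with i ≟ k | j ≟ k
  ... | yes refl | yes refl = ⊥-elim (i≢j refl)
  ... | yes refl | no _     = fi
  ... | no _     | yes refl = fj
  ... | no _     | no _     = z≤n
  two : 2 ≤ Σ< n f
  two = subst (_≤ Σ< n f)
    (trans (Σ<-distrib-+ n (δ i) (δ j)) (cong₂ _+_ (Σ<-delta n i _ i<n) (Σ<-delta n j _ j<n)))
    (Σ<-mono n le)

*-pos⁻¹ : ∀ x y → 1 ≤ x * y → 1 ≤ x × 1 ≤ y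
*-pos⁻¹ (suc x) (suc y) _   = s≤s z≤n , s≤s z≤n
*-pos⁻¹ (suc x) zero    x*0≥1 = ⊥-elim (<⇒≱ x*0≥1 (≤-reflexive (*-zeroʳ (suc x))))

Σ<-comm-*ˡ : ∀ n m (u : ℕ → ℕ) (X : ℕ → ℕ → ℕ) →
  Σ< n (λ i → Σ< m (λ j → u j * X i j)) ≡ Σ< m (λ j → u j * Σ< n (λ i → X i j))
Σ<-comm-*ˡ n m u X = trans (Σ<-comm n m (λ i j → u j * X i j)) (Σ<-ext m (λ j → Σ<-*ˡ n (u j) (λ i → X i j)))

Σ<-comm-weighted : ∀ n m (u v : ℕ → ℕ) (X : ℕ → ℕ → ℕ) →
  Σ< n (λ a → u a * Σ< m (λ b → v b * X a b)) ≡ Σ< m (λ b → v b * Σ< n (λ a → u a * X a b))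
Σ<-comm-weighted n m u v X = begin
  Σ< n (λ a → u a * Σ< m (λ b → v b * X a b))     ≡⟨ Σ<-ext n (λ a → sym (Σ<-*ˡ m (u a) (λ b → v b * X a b))) ⟩
  Σ< n (λ a → Σ< m (λ b → u a * (v b * X a b)))   ≡⟨ Σ<-ext n (λ a → Σ<-ext m (λ b → swap (u a) (v b) (X a b))) ⟩
  Σ< n (λ a → Σ< m (λ b → v b * (u a * X a b)))   ≡⟨ Σ<-comm-*ˡ n m v (λ a b → u a * X a b) ⟩
  Σ< m (λ b → v b * Σ< n (λ a → u a * X a b))     ∎
  where
  open ≡-Reasoning
  swap : ∀ x y z → x * (y * z) ≡ y * (x * z)
  swap = solve-∀

Σ<²-unique : ∀ n (u v : ℕ → ℕ) {P : ℕ → ℕ → Set} (P? : ∀ a b → Dec (P a b)) a₀ b₀ →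
  a₀ < n → b₀ < n → u a₀ ≡ 1 → v b₀ ≡ 1 → P a₀ b₀ →
  (∀ a b → a < n → b < n → 1 ≤ u a → 1 ≤ v b → P a b → a ≡ a₀ × b ≡ b₀) →
  Σ< n (λ a → u a * Σ< n (λ b → v b * 𝟙 (P? a b))) ≡ 1
Σ<²-unique n u v P? a₀ b₀ a₀<n b₀<n ua₀ vb₀ Pa₀b₀ unique = begin
  Σ< n (λ a → u a * Σ< n (λ b → v b * 𝟙 (P? a b)))  ≡⟨ Σ<-single n a₀ a₀<n otherA ⟩
  u a₀ * Σ< n (λ b → v b * 𝟙 (P? a₀ b))           ≡⟨ cong (_* _) ua₀ ⟩
  1 * Σ< n (λ b → v b * 𝟙 (P? a₀ b))              ≡⟨ *-identityˡ _ ⟩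
  Σ< n (λ b → v b * 𝟙 (P? a₀ b))                  ≡⟨ Σ<-single n b₀ b₀<n otherB ⟩
  v b₀ * 𝟙 (P? a₀ b₀)                             ≡⟨ cong₂ _*_ vb₀ (𝟙-yes (P? a₀ b₀) Pa₀b₀) ⟩
  1                                               ∎
  where
  open ≡-Reasoning
  otherA : ∀ a → a < n → a ≢ a₀ → u a * Σ< n (λ b → v b * 𝟙 (P? a b)) ≡ 0
  otherA a a<n a≢a₀ = *-annihilate (u a) _ λ ua≥1 → Σ<-zero n λ b b<n → *-annihilate (v b) _ λ vb≥1 →
    𝟙-no (P? a b) (λ Pab → a≢a₀ (proj₁ (unique a b a<n b<n ua≥1 vb≥1 Pab)))
  otherB : ∀ b → b < n → b ≢ b₀ → v b * 𝟙 (P? a₀ b) ≡ 0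
  otherB b b<n b≢b₀ = *-annihilate (v b) _ λ vb≥1 →
    𝟙-no (P? a₀ b) (λ Pa₀b → b≢b₀ (proj₂ (unique a₀ b a₀<n b<n (≤-reflexive (sym ua₀)) vb≥1 Pa₀b)))

-- Congruences and units

infix 4 _≡_[mod_]

record _≡_[mod_] (a b N : ℕ) : Set where
  constructor by
  field
    k l : ℕ
    eq  : a + k * N ≡ b + l * N

module _ {N : ℕ} where

  ≡mod-refl : ∀ {a} → a ≡ a [mod N ]
  ≡mod-refl = by 0 0 refl

  ≡mod-reflexive : ∀ {a b} → a ≡ b → a ≡ b [mod N ]
  ≡mod-reflexive refl = ≡mod-refl

  ≡mod-sym : ∀ {a b} → a ≡ b [mod N ] → b ≡ a [mod N ]
  ≡mod-sym (by k l e) = by l k (sym e)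

  ≡mod-trans : ∀ {a b c} → a ≡ b [mod N ] → b ≡ c [mod N ] → a ≡ c [mod N ]
  ≡mod-trans {a} {b} {c} (by k l e) (by k′ l′ e′) = by (k + k′) (l + l′) (begin
    a + (k + k′) * N        ≡⟨ shuffle a k k′ N ⟩
    (a + k * N) + k′ * N    ≡⟨ cong (_+ k′ * N) e ⟩
    (b + l * N) + k′ * N    ≡⟨ shuffle′ b l k′ N ⟩
    (b + k′ * N) + l * N    ≡⟨ cong (_+ l * N) e′ ⟩
    (c + l′ * N) + l * N    ≡⟨ shuffle″ c l′ l N ⟩
    c + (l + l′) * N        ∎)
    where
    open ≡-Reasoning
    shuffle : ∀ a k k′ N → a + (k + k′) * N ≡ (a + k * N) + k′ * N
    shuffle = solve-∀
    shuffle′ : ∀ b l k′ N → (b + l * N) + k′ * N ≡ (b + k′ * N) + l * N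
    shuffle′ = solve-∀
    shuffle″ : ∀ c l′ l N → (c + l′ * N) + l * N ≡ c + (l + l′) * N
    shuffle″ = solve-∀

  ≡mod-+ : ∀ {a b c d} → a ≡ b [mod N ] → c ≡ d [mod N ] → a + c ≡ b + d [mod N ]
  ≡mod-+ {a} {b} {c} {d} (by k l e) (by k′ l′ e′) = by (k + k′) (l + l′) (begin
    a + c + (k + k′) * N         ≡⟨ shuffle a c k k′ N ⟩
    (a + k * N) + (c + k′ * N)   ≡⟨ cong₂ _+_ e e′ ⟩
    (b + l * N) + (d + l′ * N)   ≡⟨ shuffle b d l l′ N ⟨
    b + d + (l + l′) * N         ∎)
    where
    open ≡-Reasoning
    shuffle : ∀ a c k k′ N → a + c + (k + k′) * N ≡ (a + k * N) + (c + k′ * N)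
    shuffle = solve-∀

  ≡mod-*ˡ : ∀ {a b} c → a ≡ b [mod N ] → c * a ≡ c * b [mod N ]
  ≡mod-*ˡ {a} {b} c (by k l e) = by (c * k) (c * l) (begin
    c * a + c * k * N   ≡⟨ distrib c a k N ⟩
    c * (a + k * N)     ≡⟨ cong (c *_) e ⟩
    c * (b + l * N)     ≡⟨ distrib c b l N ⟨
    c * b + c * l * N   ∎)
    where
    open ≡-Reasoning
    distrib : ∀ c a k N → c * a + c * k * N ≡ c * (a + k * N)
    distrib = solve-∀

  ≡mod-*ʳ : ∀ {a b} c → a ≡ b [mod N ] → a * c ≡ b * c [mod N ]
  ≡mod-*ʳ {a} {b} c h = subst₂ (_≡_[mod N ]) (*-comm c a) (*-comm c b) (≡mod-*ˡ c h)

  ≡mod-self : N ≡ 0 [mod N ]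
  ≡mod-self = by 0 1 refl

  k*N≡0 : ∀ k → k * N ≡ 0 [mod N ]
  k*N≡0 k = by 0 k (+-identityʳ _)

  ≡mod-cancelʳ-+ : ∀ {a b} c → a + c ≡ b + c [mod N ] → a ≡ b [mod N ]
  ≡mod-cancelʳ-+ {a} {b} c (by k l e) = by k l (+-cancelʳ-≡ c _ _ (begin
    a + k * N + c   ≡⟨ shuffle a k N c ⟩
    a + c + k * N   ≡⟨ e ⟩
    b + c + l * N   ≡⟨ shuffle b l N c ⟨
    b + l * N + c   ∎))
    where
    open ≡-Reasoning
    shuffle : ∀ a k N c → a + k * N + c ≡ a + c + k * N
    shuffle = solve-∀

  ≡mod-resp-∣ : ∀ {a b d} → d ∣ N → a ≡ b [mod N ] → d ∣ a → d ∣ b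
  ≡mod-resp-∣ {a} {b} {d} d∣N (by k l e) d∣a =
    ∣m+n∣m⇒∣n (subst (d ∣_) (trans e (+-comm b (l * N))) (∣m∣n⇒∣m+n d∣a (∣n⇒∣m*n k d∣N))) (∣n⇒∣m*n l d∣N)

  gcd-≡mod : ∀ {a b} → a ≡ b [mod N ] → gcd a N ≡ gcd b N
  gcd-≡mod {a} {b} h = ∣-antisym
    (gcd-greatest (≡mod-resp-∣ (gcd[m,n]∣n a N) h (gcd[m,n]∣m a N)) (gcd[m,n]∣n a N))
    (gcd-greatest (≡mod-resp-∣ (gcd[m,n]∣n b N) (≡mod-sym h) (gcd[m,n]∣m b N)) (gcd[m,n]∣n b N))

≡mod-∣ : ∀ {N d a b} → d ∣ N → a ≡ b [mod N ] → a ≡ b [mod d ]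
≡mod-∣ {a = a} {b} (divides q refl) (by k l e) =
  by (k * q) (l * q) (trans (cong (a +_) (*-assoc k q _)) (trans e (cong (b +_) (sym (*-assoc l q _)))))

≡mod-scale : ∀ {c D a b} → a ≡ b [mod D ] → c * a ≡ c * b [mod c * D ]
≡mod-scale {c} {D} {a} {b} (by k l e) = by k l (begin
  c * a + k * (c * D)   ≡⟨ distrib c a k D ⟨
  c * (a + k * D)       ≡⟨ cong (c *_) e ⟩
  c * (b + l * D)       ≡⟨ distrib c b l D ⟩
  c * b + l * (c * D)   ∎)
  where
  open ≡-Reasoning
  distrib : ∀ c a k D → c * (a + k * D) ≡ c * a + k * (c * D)
  distrib = solve-∀

≡mod-unscale : ∀ {c D a b} .{{_ : NonZero c}} → c * a ≡ c * b [mod c * D ] → a ≡ b [mod D ]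
≡mod-unscale {c} {D} {a} {b} (by k l e) = by k l (*-cancelˡ-≡ _ _ c (begin
  c * (a + k * D)       ≡⟨ distrib c a k D ⟩
  c * a + k * (c * D)   ≡⟨ e ⟩
  c * b + l * (c * D)   ≡⟨ distrib c b l D ⟨
  c * (b + l * D)       ∎))
  where
  open ≡-Reasoning
  distrib : ∀ c a k D → c * (a + k * D) ≡ c * a + k * (c * D)
  distrib = solve-∀

module _ (N : ℕ) .{{_ : NonZero N}} where

  ≡mod-% : ∀ a → a ≡ a % N [mod N ]
  ≡mod-% a = by 0 (a / N) (trans (+-identityʳ a) (m≡m%n+[m/n]*n a N))

  ≡mod⇒%≡ : ∀ {a b} → a ≡ b [mod N ] → a % N ≡ b % N
  ≡mod⇒%≡ {a} {b} (by k l e) = begin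
    a % N            ≡⟨ %-remove-+ʳ a (n∣m*n k) ⟨
    (a + k * N) % N  ≡⟨ cong (_% N) e ⟩
    (b + l * N) % N  ≡⟨ %-remove-+ʳ b (n∣m*n l) ⟩
    b % N            ∎
    where open ≡-Reasoning

  %≡⇒≡mod : ∀ {a b} → a % N ≡ b % N → a ≡ b [mod N ]
  %≡⇒≡mod {a} {b} e = ≡mod-trans (≡mod-% a) (subst (_≡ b [mod N ]) (sym e) (≡mod-sym (≡mod-% b)))

  %≡0⇒≡mod : ∀ {a} → a % N ≡ 0 → a ≡ 0 [mod N ]
  %≡0⇒≡mod {a} e = subst (a ≡_[mod N ]) e (≡mod-% a)

  ≡mod⇒%≡0 : ∀ {a} → a ≡ 0 [mod N ] → a % N ≡ 0
  ≡mod⇒%≡0 h = trans (≡mod⇒%≡ h) (m<n⇒m%n≡m (>-nonZero⁻¹ N))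

  ≡mod⇒≡ : ∀ {a b} → a < N → b < N → a ≡ b [mod N ] → a ≡ b
  ≡mod⇒≡ {a} {b} a<N b<N h = trans (sym (m<n⇒m%n≡m a<N)) (trans (≡mod⇒%≡ h) (m<n⇒m%n≡m b<N))

≡modℕ : ∀ {N} x → 1 ≤ N → x ≡ modℕ x N [mod N ]
≡modℕ {suc n} x _ = ≡mod-% (suc n) x

modℕ< : ∀ {N} x → 1 ≤ N → modℕ x N < N
modℕ< {suc n} x _ = m%n<n x (suc n)

≡mod⇒modℕ≡ : ∀ {N x y} → 1 ≤ N → x ≡ y [mod N ] → modℕ x N ≡ modℕ y N
≡mod⇒modℕ≡ {suc n} _ = ≡mod⇒%≡ (suc n)

modℕ≡⇒≡mod : ∀ {N x y} → 1 ≤ N → modℕ x N ≡ modℕ y N → x ≡ y [mod N ]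
modℕ≡⇒≡mod {suc n} _ = %≡⇒≡mod (suc n)

modℕ-id : ∀ {N x} → x < N → modℕ x N ≡ x
modℕ-id {suc n} = m<n⇒m%n≡m

gcd-*-unitˡ : ∀ {h N} v → gcd h N ≡ 1 → gcd (h * v) N ≡ gcd v N
gcd-*-unitˡ {h} {N} v gh = ∣-antisym
  (gcd-greatest (coprime-divisor coprime (gcd[m,n]∣m (h * v) N)) (gcd[m,n]∣n (h * v) N))
  (gcd-greatest (∣n⇒∣m*n h (gcd[m,n]∣m v N)) (gcd[m,n]∣n v N))
  where
  coprime : Coprime (gcd (h * v) N) h
  coprime (d∣g , d∣h) = ∣1⇒≡1 (subst (_ ∣_) gh (gcd-greatest d∣h (∣-trans d∣g (gcd[m,n]∣n (h * v) N))))

gcd-unit-∣ : ∀ {h N d} → d ∣ N → gcd h N ≡ 1 → gcd h d ≡ 1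
gcd-unit-∣ {h} {N} {d} d∣N gh =
  ∣1⇒≡1 (subst (_ ∣_) gh (gcd-greatest (gcd[m,n]∣m h d) (∣-trans (gcd[m,n]∣n h d) d∣N)))

gcd-*-units : ∀ {a b N} → gcd a N ≡ 1 → gcd b N ≡ 1 → gcd (a * b) N ≡ 1
gcd-*-units {a} {b} ga gb = trans (gcd-*-unitˡ {a} b ga) gb

unit⇒inverse : ∀ {v D} → 1 ≤ D → gcd v D ≡ 1 → ∃[ w ] v * w ≡ 1 [mod D ]
unit⇒inverse {v} {D} 1≤D gv with coprime-Bézout (gcd≡1⇒coprime gv)
... | Bézout.+- x y eq = x , by 0 y (trans (+-identityʳ _) (trans (*-comm v x) (sym eq)))
... | Bézout.-+ x y eq = x * (D ∸ 1) , by y (v * x) (begin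
  v * (x * (D ∸ 1)) + y * D          ≡⟨ cong (v * (x * (D ∸ 1)) +_) eq ⟨
  v * (x * (D ∸ 1)) + (1 + x * v)    ≡⟨ shuffle v x (D ∸ 1) ⟩
  1 + v * x * (1 + (D ∸ 1))          ≡⟨ cong (λ z → 1 + v * x * z) (m+[n∸m]≡n 1≤D) ⟩
  1 + v * x * D                      ∎)
  where
  open ≡-Reasoning
  shuffle : ∀ v x d → v * (x * d) + (1 + x * v) ≡ 1 + v * x * (1 + d)
  shuffle = solve-∀

inverse⇒unit : ∀ {D} v w → v * w ≡ 1 [mod D ] → gcd w D ≡ 1
inverse⇒unit {D} v w vw≡1 = ∣1⇒≡1 (subst (gcd w D ∣_) (trans (gcd-≡mod vw≡1) (gcd-zeroˡ D))
  (gcd-greatest (∣n⇒∣m*n v (gcd[m,n]∣m w D)) (gcd[m,n]∣n w D)))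

≡mod-*-inverse : ∀ {D} u v w → v * w ≡ 1 [mod D ] → u * v * w ≡ u [mod D ]
≡mod-*-inverse {D} u v w vw≡1 =
  subst₂ (_≡_[mod D ]) (sym (*-assoc u v w)) (*-identityʳ u) (≡mod-*ˡ u vw≡1)

≡mod-cancel-unitˡ : ∀ {D x y} l μ → l * μ ≡ 1 [mod D ] → l * x ≡ l * y [mod D ] → x ≡ y [mod D ]
≡mod-cancel-unitˡ {D} {x} {y} l μ lμ≡1 lx≡ly =
  ≡mod-trans (≡mod-sym (restore x)) (≡mod-trans (≡mod-*ˡ μ lx≡ly) (restore y))
  where
  restore : ∀ z → μ * (l * z) ≡ z [mod D ]
  restore z = subst (_≡ z [mod D ]) (shuffle z l μ) (≡mod-*-inverse z l μ lμ≡1)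
    where
    shuffle : ∀ z l μ → z * l * μ ≡ μ * (l * z)
    shuffle = solve-∀

prime∤1 : ∀ {q} → Prime q → ¬ q ∣ 1
prime∤1 q-prime q∣1 with ∣1⇒≡1 q∣1
... | refl = nonTrivial⇒≢1 {{prime⇒nonTrivial q-prime}} refl

prime-divisor : ∀ s → 2 ≤ s → ∃[ q ] (Prime q × q ∣ s)
prime-divisor s@(suc _) 2≤s with factorise s
... | record { factors = [] ; isFactorisation = e } = ⊥-elim (<⇒≢ 2≤s (sym e))
... | record { factors = q ∷ qs ; isFactorisation = e ; factorsPrime = q-prime ∷ _ } =
  q , q-prime , divides (product qs) (trans e (*-comm q (product qs)))

-- Every unit modulo a divisor D of M lifts to a unit modulo M: add to r a multiple of D
-- divisible exactly by the primes of M that do not divide r.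
unit-lift : ∀ {M D r} .{{_ : NonZero M}} → D ∣ M → gcd r D ≡ 1 → ∃[ l ] (gcd l M ≡ 1 × (l ≡ r [mod D ]))
unit-lift {M} {D} {r} D∣M gr = l , gcd-l-M , by 0 t (trans (+-identityʳ l) (cong (r +_) (*-comm D t)))
  where
  open PrimeFactorisation (factorise M)
  ∤r? : ∀ q → Dec (¬ q ∣ r)
  ∤r? q = ¬? (q ∣? r)
  t = product (filter ∤r? factors)
  l = r + D * t
  ∣t⇒∤r : ∀ {ℓ} → Prime ℓ → ℓ ∣ t → ¬ ℓ ∣ r
  ∣t⇒∤r ℓ-prime ℓ∣t = proj₂ (∈-filter⁻ ∤r? {xs = factors}
    (factorisationHasAllPrimeFactors ℓ-prime ℓ∣t (All.filter⁺ ∤r? {xs = factors} factorsPrime)))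
  ∣M∤r⇒∣t : ∀ {ℓ} → Prime ℓ → ℓ ∣ M → ¬ ℓ ∣ r → ℓ ∣ t
  ∣M∤r⇒∣t ℓ-prime ℓ∣M ℓ∤r = ∈⇒∣product (∈-filter⁺ ∤r?
    (factorisationHasAllPrimeFactors ℓ-prime (subst (_ ∣_) isFactorisation ℓ∣M) factorsPrime) ℓ∤r)
  no-common-prime : ∀ {ℓ} → Prime ℓ → ℓ ∣ l → ℓ ∣ M → ⊥
  no-common-prime {ℓ} ℓ-prime ℓ∣l ℓ∣M with ℓ ∣? r
  ... | no ℓ∤r = ℓ∤r (∣m+n∣m⇒∣n (subst (ℓ ∣_) (+-comm r (D * t)) ℓ∣l)
                           (∣n⇒∣m*n D (∣M∤r⇒∣t ℓ-prime ℓ∣M ℓ∤r)))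
  ... | yes ℓ∣r with euclidsLemma D t ℓ-prime (∣m+n∣m⇒∣n ℓ∣l ℓ∣r)
  ...   | inj₁ ℓ∣D = prime∤1 ℓ-prime (subst (ℓ ∣_) gr (gcd-greatest ℓ∣r ℓ∣D))
  ...   | inj₂ ℓ∣t = ∣t⇒∤r ℓ-prime ℓ∣t ℓ∣r
  gcd-l-M : gcd l M ≡ 1
  gcd-l-M with gcd l M in e
  ... | 0 = ⊥-elim (≢-nonZero⁻¹ M (gcd[m,n]≡0⇒n≡0 l e))
  ... | 1 = refl
  ... | suc (suc g) with prime-divisor (gcd l M) (subst (2 ≤_) (sym e) (s≤s (s≤s z≤n)))
  ...   | ℓ , ℓ-prime , ℓ∣g =
    ⊥-elim (no-common-prime ℓ-prime (∣-trans ℓ∣g (gcd[m,n]∣m l M)) (∣-trans ℓ∣g (gcd[m,n]∣n l M)))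

-- The Frobenius congruence

-- A list x of exponents stands for the polynomial Σ_{e ∈ x} X^e with natural coefficients;
-- it is known through its pairings Σ_{e ∈ x} g e with all test functions g.
eval : List ℕ → (ℕ → ℕ) → ℕ
eval []       g = 0
eval (e ∷ x) g = g e + eval x g

infixl 7 _⊗_

_⊗_ : List ℕ → List ℕ → List ℕ
[]      ⊗ y = []
(e ∷ x) ⊗ y = map (e +_) y ++ x ⊗ y

infix 4 _≈ₚ_

_≈ₚ_ : List ℕ → List ℕ → Set
x ≈ₚ y = ∀ g → eval x g ≡ eval y g

eval-++ : ∀ x y g → eval (x ++ y) g ≡ eval x g + eval y g
eval-++ []      y g = refl
eval-++ (e ∷ x) y g rewrite eval-++ x y g = sym (+-assoc (g e) _ _)

eval-cong : ∀ x {g h} → (∀ t → g t ≡ h t) → eval x g ≡ eval x h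
eval-cong []      _  = refl
eval-cong (e ∷ x) eq = cong₂ _+_ (eq e) (eval-cong x eq)

eval-shift : ∀ e y g → eval (map (e +_) y) g ≡ eval y (λ t → g (e + t))
eval-shift e []      g = refl
eval-shift e (t ∷ y) g = cong (g (e + t) +_) (eval-shift e y g)

eval-⊗ : ∀ x y g → eval (x ⊗ y) g ≡ eval x (λ e → eval y (λ t → g (e + t)))
eval-⊗ []      y g = refl
eval-⊗ (e ∷ x) y g = trans (eval-++ (map (e +_) y) (x ⊗ y) g) (cong₂ _+_ (eval-shift e y g) (eval-⊗ x y g))

eval-+ : ∀ x g h → eval x (λ t → g t + h t) ≡ eval x g + eval x h
eval-+ []      g h = refl
eval-+ (e ∷ x) g h rewrite eval-+ x g h = shuffle (g e) (h e) (eval x g) (eval x h)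
  where
  shuffle : ∀ a b c d → a + b + (c + d) ≡ a + c + (b + d)
  shuffle = solve-∀

eval-0 : ∀ x → eval x (λ _ → 0) ≡ 0
eval-0 []      = refl
eval-0 (_ ∷ x) = eval-0 x

eval-comm : ∀ x y (G : ℕ → ℕ → ℕ) → eval x (λ e → eval y (G e)) ≡ eval y (λ t → eval x (λ e → G e t))
eval-comm []      y G = sym (eval-0 y)
eval-comm (e ∷ x) y G =
  trans (cong (eval y (G e) +_) (eval-comm x y G)) (sym (eval-+ y (G e) (λ t → eval x (λ e → G e t))))

⊗-comm : ∀ x y → x ⊗ y ≈ₚ y ⊗ x
⊗-comm x y g = begin
  eval (x ⊗ y) g                                  ≡⟨ eval-⊗ x y g ⟩
  eval x (λ e → eval y (λ t → g (e + t)))         ≡⟨ eval-comm x y _ ⟩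
  eval y (λ t → eval x (λ e → g (e + t)))         ≡⟨ eval-cong y (λ t → eval-cong x (λ e → cong g (+-comm e t))) ⟩
  eval y (λ t → eval x (λ e → g (t + e)))         ≡⟨ eval-⊗ y x g ⟨
  eval (y ⊗ x) g                                  ∎
  where open ≡-Reasoning

polySemiring : Semiring 0ℓ 0ℓ
polySemiring = record
  { Carrier = List ℕ
  ; _≈_ = _≈ₚ_
  ; _+_ = _++_
  ; _*_ = _⊗_
  ; 0# = []
  ; 1# = 0 ∷ []
  ; isSemiring = record
    { isSemiringWithoutAnnihilatingZero = record
      { +-isCommutativeMonoid = record
        { isMonoid = record
          { isSemigroup = record
            { isMagma = record { isEquivalence = ≈ₚ-isEquivalence ; ∙-cong = λ {x y u v} → ++-cong {x} {y} {u} {v} }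
            ; assoc = ++-assoc }
          ; identity = (λ _ _ → refl) , ++-identityʳ }
        ; comm = ++-comm }
      ; *-cong = λ {x y u v} → ⊗-cong {x} {y} {u} {v}
      ; *-assoc = ⊗-assoc
      ; *-identity = ⊗-identityˡ , ⊗-identityʳ
      ; distrib = ⊗-distribˡ , ⊗-distribʳ }
    ; zero = (λ _ _ → refl) , ⊗-zeroʳ } }
  where
  ≈ₚ-isEquivalence : IsEquivalence _≈ₚ_
  ≈ₚ-isEquivalence = record { refl = λ _ → refl ; sym = λ e g → sym (e g) ; trans = λ e e′ g → trans (e g) (e′ g) }
  ++-cong : ∀ {x y u v} → x ≈ₚ y → u ≈ₚ v → x ++ u ≈ₚ y ++ v
  ++-cong {x} {y} {u} {v} e e′ g = trans (eval-++ x u g) (trans (cong₂ _+_ (e g) (e′ g)) (sym (eval-++ y v g)))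
  ++-assoc : ∀ x y z → (x ++ y) ++ z ≈ₚ x ++ (y ++ z)
  ++-assoc x y z g rewrite eval-++ (x ++ y) z g | eval-++ x y g | eval-++ x (y ++ z) g | eval-++ y z g =
    +-assoc (eval x g) _ _
  ++-identityʳ : ∀ x → x ++ [] ≈ₚ x
  ++-identityʳ x g = trans (eval-++ x [] g) (+-identityʳ _)
  ++-comm : ∀ x y → x ++ y ≈ₚ y ++ x
  ++-comm x y g = trans (eval-++ x y g) (trans (+-comm (eval x g) _) (sym (eval-++ y x g)))
  ⊗-cong : ∀ {x y u v} → x ≈ₚ y → u ≈ₚ v → x ⊗ u ≈ₚ y ⊗ v
  ⊗-cong {x} {y} {u} {v} e e′ g =
    trans (eval-⊗ x u g) (trans (e _) (trans (eval-cong y (λ _ → e′ _)) (sym (eval-⊗ y v g))))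
  ⊗-assoc : ∀ x y z → (x ⊗ y) ⊗ z ≈ₚ x ⊗ (y ⊗ z)
  ⊗-assoc x y z g rewrite eval-⊗ (x ⊗ y) z g | eval-⊗ x y (λ e → eval z (λ s → g (e + s)))
    | eval-⊗ x (y ⊗ z) g =
    eval-cong x λ e → trans (eval-cong y λ t → eval-cong z λ s → cong g (+-assoc e t s))
                            (sym (eval-⊗ y z (λ t → g (e + t))))
  ⊗-identityˡ : ∀ x → (0 ∷ []) ⊗ x ≈ₚ x
  ⊗-identityˡ x g = trans (eval-⊗ (0 ∷ []) x g) (+-identityʳ _)
  ⊗-identityʳ : ∀ x → x ⊗ (0 ∷ []) ≈ₚ x
  ⊗-identityʳ x g = trans (eval-⊗ x (0 ∷ []) g) (eval-cong x (λ e → trans (+-identityʳ _) (cong g (+-identityʳ e))))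
  ⊗-distribˡ : ∀ x y z → x ⊗ (y ++ z) ≈ₚ x ⊗ y ++ x ⊗ z
  ⊗-distribˡ x y z g rewrite eval-⊗ x (y ++ z) g | eval-++ (x ⊗ y) (x ⊗ z) g | eval-⊗ x y g | eval-⊗ x z g =
    trans (eval-cong x (λ e → eval-++ y z _)) (eval-+ x _ _)
  ⊗-distribʳ : ∀ x y z → (y ++ z) ⊗ x ≈ₚ y ⊗ x ++ z ⊗ x
  ⊗-distribʳ x y z g rewrite eval-⊗ (y ++ z) x g | eval-++ (y ⊗ x) (z ⊗ x) g | eval-⊗ y x g | eval-⊗ z x g =
    eval-++ y z _
  ⊗-zeroʳ : ∀ x → x ⊗ [] ≈ₚ []
  ⊗-zeroʳ x g = trans (eval-⊗ x [] g) (eval-0 x)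

open import Algebra.Properties.Semiring.Exp polySemiring using () renaming (_^_ to _^ₚ_)
open import Algebra.Properties.Semiring.Mult polySemiring using () renaming (_×_ to _×ₚ_)
open import Algebra.Properties.Semiring.Sum polySemiring using () renaming (sum to sumₚ)
import Algebra.Properties.Semiring.Binomial polySemiring as Binomial

eval-×ₚ : ∀ n x g → eval (n ×ₚ x) g ≡ n * eval x g
eval-×ₚ zero    x g = refl
eval-×ₚ (suc n) x g = trans (eval-++ x (n ×ₚ x) g) (cong (eval x g +_) (eval-×ₚ n x g))

eval-sumₚ : ∀ n (F : ℕ → List ℕ) g → eval (sumₚ {n} (λ i → F (toℕ i))) g ≡ Σ< n (λ k → eval (F k) g)
eval-sumₚ zero    F g = refl
eval-sumₚ (suc n) F g = trans (eval-++ (F 0) _ g) (cong (eval (F 0) g +_) (eval-sumₚ n (λ k → F (suc k)) g))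

eval-singleton^ : ∀ n e g → eval ((e ∷ []) ^ₚ n) g ≡ g (n * e)
eval-singleton^ zero    e g = +-identityʳ _
eval-singleton^ (suc n) e g =
  trans (eval-⊗ (e ∷ []) ((e ∷ []) ^ₚ n) g) (trans (+-identityʳ _) (eval-singleton^ n e (λ t → g (e + t))))

≡mod-Σ< : ∀ {N} n (f g : ℕ → ℕ) → (∀ k → k < n → f k ≡ g k [mod N ]) → Σ< n f ≡ Σ< n g [mod N ]
≡mod-Σ< zero    f g h = ≡mod-refl
≡mod-Σ< (suc n) f g h =
  ≡mod-+ (h 0 (s≤s z≤n)) (≡mod-Σ< n (λ k → f (suc k)) (λ k → g (suc k)) (λ k k<n → h (suc k) (s≤s k<n)))

∣⇒*≡0 : ∀ {q c} X → q ∣ c → c * X ≡ 0 [mod q ]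
∣⇒*≡0 {q} X (divides d refl) = subst (_≡ 0 [mod q ]) (shuffle d q X) (k*N≡0 (d * X))
  where
  shuffle : ∀ d q X → d * X * q ≡ d * q * X
  shuffle = solve-∀

prime∤! : ∀ {q} → Prime q → ∀ j → j < q → ¬ q ∣ j !
prime∤! q-prime zero    _   = prime∤1 q-prime
prime∤! q-prime (suc j) j<q q∣ with euclidsLemma (suc j) (j !) q-prime q∣
... | inj₁ q∣j  = <⇒≱ j<q (∣⇒≤ q∣j)
... | inj₂ q∣j! = prime∤! q-prime j (≤-trans (n≤1+n (suc j)) j<q) q∣j!

prime∣C : ∀ {q k} → Prime q → 0 < k → k < q → q ∣ (q C k)
prime∣C {q@(suc q′)} {k} q-prime 0<k k<q
  with euclidsLemma (q C k) (k ! * (q ∸ k) !) q-prime (subst (q ∣_) (sym C*k!*[q∸k]!≡q!) (m∣m*n (q′ !)))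
  where
  instance _ = k !* (q ∸ k) !≢0
  C*k!*[q∸k]!≡q! : (q C k) * (k ! * (q ∸ k) !) ≡ q !
  C*k!*[q∸k]!≡q! = trans (cong (_* (k ! * (q ∸ k) !)) (nCk≡n!/k![n-k]! (<⇒≤ k<q)))
                         (m/n*n≡m (k![n∸k]!∣n! (<⇒≤ k<q)))
... | inj₁ q∣C = q∣C
... | inj₂ q∣k![q∸k]! with euclidsLemma (k !) ((q ∸ k) !) q-prime q∣k![q∸k]!
...   | inj₁ q∣k!     = ⊥-elim (prime∤! q-prime k k<q q∣k!)
...   | inj₂ q∣[q∸k]! = ⊥-elim (prime∤! q-prime (q ∸ k) (∸-monoʳ-< 0<k (<⇒≤ k<q)) q∣[q∸k]!)

frobenius-++ : ∀ {q} → Prime q → ∀ x y g →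
  eval ((x ++ y) ^ₚ q) g ≡ eval (x ^ₚ q) g + eval (y ^ₚ q) g [mod q ]
frobenius-++ {q@(suc q′)} q-prime x y g =
  subst (eval ((x ++ y) ^ₚ q) g ≡_[mod q ]) (+-comm (eval (y ^ₚ q) g) _)
    (≡mod-trans (≡mod-reflexive expand)
      (≡mod-+ (≡mod-reflexive first) (≡mod-+ middle (≡mod-reflexive last))))
  where
  T : ℕ → ℕ
  T k = (q C k) * eval (x ^ₚ k ⊗ y ^ₚ (q ∸ k)) g
  expand : eval ((x ++ y) ^ₚ q) g ≡ T 0 + (Σ< q′ (λ k → T (suc k)) + T q)
  expand = begin
    eval ((x ++ y) ^ₚ q) g
      ≡⟨ Binomial.theorem x y (⊗-comm x y) q g ⟩
    eval (sumₚ {suc q} (λ i → (q C toℕ i) ×ₚ (x ^ₚ toℕ i ⊗ y ^ₚ (q ∸ toℕ i)))) g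
      ≡⟨ eval-sumₚ (suc q) (λ k → (q C k) ×ₚ (x ^ₚ k ⊗ y ^ₚ (q ∸ k))) g ⟩
    Σ< (suc q) (λ k → eval ((q C k) ×ₚ (x ^ₚ k ⊗ y ^ₚ (q ∸ k))) g)
      ≡⟨ Σ<-ext (suc q) (λ k → eval-×ₚ (q C k) (x ^ₚ k ⊗ y ^ₚ (q ∸ k)) g) ⟩
    T 0 + Σ< q (λ k → T (suc k))
      ≡⟨ cong (T 0 +_) (Σ<-init-last q′ (λ k → T (suc k))) ⟩
    T 0 + (Σ< q′ (λ k → T (suc k)) + T q) ∎
    where open ≡-Reasoning
  first : T 0 ≡ eval (y ^ₚ q) g
  first = trans (+-identityʳ _) (trans (eval-⊗ (0 ∷ []) (y ^ₚ q) g) (+-identityʳ _))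
  last : T q ≡ eval (x ^ₚ q) g
  last = begin
    (q C q) * eval (x ^ₚ q ⊗ y ^ₚ (q ∸ q)) g  ≡⟨ cong₂ (λ c d → c * eval (x ^ₚ q ⊗ y ^ₚ d) g) (nCn≡1 q) (n∸n≡0 q′) ⟩
    1 * eval (x ^ₚ q ⊗ (0 ∷ [])) g            ≡⟨ *-identityˡ _ ⟩
    eval (x ^ₚ q ⊗ (0 ∷ [])) g                ≡⟨ eval-⊗ (x ^ₚ q) (0 ∷ []) g ⟩
    eval (x ^ₚ q) (λ e → g (e + 0) + 0)       ≡⟨ eval-cong (x ^ₚ q) (λ e → trans (+-identityʳ _) (cong g (+-identityʳ e))) ⟩
    eval (x ^ₚ q) g                           ∎
    where open ≡-Reasoning
  middle : Σ< q′ (λ k → T (suc k)) ≡ 0 [mod q ]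
  middle = subst (Σ< q′ (λ k → T (suc k)) ≡_[mod q ]) (Σ<-zero q′ (λ _ _ → refl))
    (≡mod-Σ< q′ (λ k → T (suc k)) (λ _ → 0)
      (λ k k<q′ → ∣⇒*≡0 (eval (x ^ₚ suc k ⊗ y ^ₚ (q ∸ suc k)) g) (prime∣C q-prime (s≤s z≤n) (s≤s k<q′))))

weighted : ℕ → (ℕ → ℕ) → (ℕ → ℕ) → List ℕ
weighted zero    w e = []
weighted (suc n) w e = replicate (w 0) (e 0) ++ weighted n (λ k → w (suc k)) (λ k → e (suc k))

eval-replicate : ∀ k e g → eval (replicate k e) g ≡ k * g e
eval-replicate zero    e g = refl
eval-replicate (suc k) e g = cong (g e +_) (eval-replicate k e g)

eval-weighted : ∀ n w e g → eval (weighted n w e) g ≡ Σ< n (λ b → w b * g (e b))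
eval-weighted zero    w e g = refl
eval-weighted (suc n) w e g = trans (eval-++ (replicate (w 0) (e 0)) _ g)
  (cong₂ _+_ (eval-replicate (w 0) (e 0) g) (eval-weighted n (λ k → w (suc k)) (λ k → e (suc k)) g))

frobenius : ∀ {q} → Prime q → ∀ n w e → (∀ k → w k ≤ 1) → ∀ g →
  eval (weighted n w e ^ₚ q) g ≡ Σ< n (λ b → w b * g (q * e b)) [mod q ]
frobenius {q@(suc _)} q-prime zero    w e w≤1 g = ≡mod-refl
frobenius {q@(suc _)} q-prime (suc n) w e w≤1 g =
  ≡mod-trans (frobenius-++ q-prime (replicate (w 0) (e 0)) (weighted n w′ e′) g)
    (≡mod-+ head (frobenius q-prime n w′ e′ (λ k → w≤1 (suc k)) g))
  where
  w′ e′ : ℕ → ℕ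
  w′ k = w (suc k)
  e′ k = e (suc k)
  head : eval (replicate (w 0) (e 0) ^ₚ q) g ≡ w 0 * g (q * e 0) [mod q ]
  head with w 0 | w≤1 0
  ... | 0 | _ = ≡mod-refl
  ... | 1 | _ = ≡mod-reflexive (trans (eval-singleton^ q (e 0) g) (sym (+-identityʳ _)))
  ... | 2+ _ | s≤s ()

-- Tilings and their dilations

-- χA, χB are the indicator functions of A, B ⊆ ℤ_M; reps s c counts the pairs (a , b) with
-- a + s b + c ≡ 0, so that A ⊕ s·B = ℤ_M is "Tiles s".
module Tiling (m : ℕ) (χA χB : ℕ → ℕ) (χB≤1 : ∀ k → χB k ≤ 1) where

  M : ℕ
  M = suc m

  reps : ℕ → ℕ → ℕ
  reps s c = Σ< M (λ a → χA a * Σ< M (λ b → χB b * 𝟙 ((a + s * b + c) % M ≟ 0)))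

  Tiles : ℕ → Set
  Tiles s = ∀ c → reps s c ≡ 1

  |A| |B| : ℕ
  |A| = Σ< M χA
  |B| = Σ< M χB

  𝟙-≡0-cong : ∀ {x y} → x ≡ y → 𝟙 (x ≟ 0) ≡ 𝟙 (y ≟ 0)
  𝟙-≡0-cong = cong (λ z → 𝟙 (z ≟ 0))

  unique-complement : ∀ x → Σ< M (λ c → 𝟙 ((x + c) % M ≟ 0)) ≡ 1
  unique-complement x = Σ<-𝟙-unique M c₀ (λ c → (x + c) % M ≟ 0) (m%n<n (M ∸ x % M) M) (≡mod⇒%≡ M x+c₀≡0) unique
    where
    c₀ = (M ∸ x % M) % M
    x+c₀≡0 : x + c₀ ≡ 0 [mod M ]
    x+c₀≡0 = ≡mod-trans (≡mod-+ (≡mod-% M x) (≡mod-sym (≡mod-% M (M ∸ x % M))))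
      (subst (_≡ 0 [mod M ]) (sym (m+[n∸m]≡n (m%n≤n x M))) ≡mod-self)
    unique : ∀ c → c < M → (x + c) % M ≡ 0 → c ≡ c₀
    unique c c<M x+c≡0 = ≡mod⇒≡ M c<M (m%n<n (M ∸ x % M) M) (≡mod-cancelʳ-+ x
      (subst₂ (_≡_[mod M ]) (+-comm x c) (+-comm x c₀) (≡mod-trans (%≡⇒≡mod M x+c≡0) (≡mod-sym x+c₀≡0))))

  Σ<-reps : ∀ s → Σ< M (reps s) ≡ |A| * |B|
  Σ<-reps s = begin
    Σ< M (λ c → Σ< M (λ a → χA a * Σ< M (λ b → χB b * I a b c)))
      ≡⟨ Σ<-comm-*ˡ M M χA (λ c a → Σ< M (λ b → χB b * I a b c)) ⟩
    Σ< M (λ a → χA a * Σ< M (λ c → Σ< M (λ b → χB b * I a b c)))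
      ≡⟨ Σ<-ext M (λ a → cong (χA a *_) (Σ<-comm-*ˡ M M χB (λ c b → I a b c))) ⟩
    Σ< M (λ a → χA a * Σ< M (λ b → χB b * Σ< M (I a b)))
      ≡⟨ Σ<-ext M (λ a → cong (χA a *_) (Σ<-ext M (λ b → cong (χB b *_) (unique-complement (a + s * b))))) ⟩
    Σ< M (λ a → χA a * Σ< M (λ b → χB b * 1))
      ≡⟨ Σ<-ext M (λ a → cong (χA a *_) (Σ<-ext M (λ b → *-identityʳ (χB b)))) ⟩
    Σ< M (λ a → χA a * |B|)
      ≡⟨ Σ<-*ʳ M |B| χA ⟩
    |A| * |B| ∎
    where
    open ≡-Reasoning
    I : ℕ → ℕ → ℕ → ℕ
    I a b c = 𝟙 ((a + s * b + c) % M ≟ 0)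

  reps-cong : ∀ {s s′ c c′} → s ≡ s′ [mod M ] → c ≡ c′ [mod M ] → reps s c ≡ reps s′ c′
  reps-cong s≡s′ c≡c′ = Σ<-ext M (λ a → cong (χA a *_) (Σ<-ext M (λ b → cong (χB b *_)
    (𝟙-≡0-cong (≡mod⇒%≡ M (≡mod-+ (≡mod-+ (≡mod-refl {a = a}) (≡mod-*ʳ b s≡s′)) c≡c′))))))

  reps-witness : ∀ s c → 1 ≤ reps s c →
    ∃[ a ] ∃[ b ] (a < M × b < M × 1 ≤ χA a × 1 ≤ χB b × (a + s * b + c) % M ≡ 0)
  reps-witness s c reps≥1 with Σ<-pos M _ reps≥1
  ... | a , a<M , term≥1 with *-pos⁻¹ (χA a) _ term≥1
  ...   | χA≥1 , inner≥1 with Σ<-pos M _ inner≥1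
  ...     | b , b<M , term′≥1 with *-pos⁻¹ (χB b) _ term′≥1
  ...       | χB≥1 , hit = a , b , a<M , b<M , χA≥1 , χB≥1 , 𝟙-pos (_ ≟ 0) hit

  tiles⇒|A||B|≡M : ∀ s → Tiles s → |A| * |B| ≡ M
  tiles⇒|A||B|≡M s tiles = trans (sym (Σ<-reps s)) (trans (Σ<-ext M tiles) (trans (Σ<-const M 1) (*-identityʳ M)))

  -- Σ_c reps s c = |A| |B| = M, so if no reps s c vanishes then all are 1.
  reps-pos⇒tiles : ∀ s → |A| * |B| ≡ M → (∀ c → c < M → 1 ≤ reps s c) → Tiles s
  reps-pos⇒tiles s |A||B|≡M pos c = trans (reps-cong {s} {s} ≡mod-refl (≡mod-% M c)) (sym (Σ<-tight M pos
    (trans (Σ<-const M 1) (trans (*-identityʳ M) (trans (sym |A||B|≡M) (sym (Σ<-reps s))))) (c % M) (m%n<n c M)))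

  reps≤1⇒tiles : ∀ s → |A| * |B| ≡ M → (∀ c → c < M → reps s c ≤ 1) → Tiles s
  reps≤1⇒tiles s |A||B|≡M ≤1 c = trans (reps-cong {s} {s} ≡mod-refl (≡mod-% M c)) (Σ<-tight M ≤1
    (trans (Σ<-reps s) (trans |A||B|≡M (sym (trans (Σ<-const M 1) (*-identityʳ M))))) (c % M) (m%n<n c M))

  module _ (s : ℕ) (tiles : Tiles s) where

    private
      P : List ℕ
      P = weighted M χB (λ b → s * b)

      hits : ℕ → ℕ → ℕ → ℕ
      hits a c t = 𝟙 ((a + c + t) % M ≟ 0)

    -- Fixing b₁, …, b_j, the tiling by s leaves exactly one pair (a , b₀) with
    -- a + s (b₀ + b₁ + … + b_j) + c ≡ 0.
    tuples-count : ∀ j c → Σ< M (λ a → χA a * eval (P ^ₚ suc j) (hits a c)) ≡ |B| ^ j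
    tuples-count zero c = trans (Σ<-ext M λ a → cong (χA a *_) (begin
      eval (P ⊗ (0 ∷ [])) (hits a c)                 ≡⟨ eval-⊗ P (0 ∷ []) (hits a c) ⟩
      eval P (λ e → hits a c (e + 0) + 0)            ≡⟨ eval-weighted M χB (λ b → s * b) _ ⟩
      Σ< M (λ b → χB b * (hits a c (s * b + 0) + 0)) ≡⟨ Σ<-ext M (λ b → cong (χB b *_) (trans (+-identityʳ _)
                                                          (𝟙-≡0-cong (cong (_% M) (shuffle a c (s * b)))))) ⟩
      Σ< M (λ b → χB b * 𝟙 ((a + s * b + c) % M ≟ 0)) ∎)) (tiles c)
      where
      open ≡-Reasoning
      shuffle : ∀ a c x → a + c + (x + 0) ≡ a + x + c
      shuffle = solve-∀
    tuples-count (suc j) c = begin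
      Σ< M (λ a → χA a * eval (P ⊗ P ^ₚ suc j) (hits a c))
        ≡⟨ Σ<-ext M (λ a → cong (χA a *_) (trans (eval-⊗ P (P ^ₚ suc j) (hits a c))
             (eval-weighted M χB (λ b → s * b) _))) ⟩
      Σ< M (λ a → χA a * Σ< M (λ b → χB b * eval (P ^ₚ suc j) (λ t → hits a c (s * b + t))))
        ≡⟨ Σ<-ext M (λ a → cong (χA a *_) (Σ<-ext M (λ b → cong (χB b *_)
             (eval-cong (P ^ₚ suc j) (λ t → 𝟙-≡0-cong (cong (_% M) (shuffle a c (s * b) t))))))) ⟩
      Σ< M (λ a → χA a * Σ< M (λ b → χB b * eval (P ^ₚ suc j) (hits a (c + s * b))))
        ≡⟨ Σ<-comm-weighted M M χA χB (λ a b → eval (P ^ₚ suc j) (hits a (c + s * b))) ⟩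
      Σ< M (λ b → χB b * Σ< M (λ a → χA a * eval (P ^ₚ suc j) (hits a (c + s * b))))
        ≡⟨ Σ<-ext M (λ b → cong (χB b *_) (tuples-count j (c + s * b))) ⟩
      Σ< M (λ b → χB b * |B| ^ j)
        ≡⟨ Σ<-*ʳ M (|B| ^ j) χB ⟩
      |B| * |B| ^ j ∎
      where
      open ≡-Reasoning
      shuffle : ∀ a c x t → a + c + (x + t) ≡ a + (c + x) + t
      shuffle = solve-∀

    -- Counting q-tuples modulo q, only the diagonal ones survive (Frobenius), and they count
    -- the representations for the dilation by q s.
    dilate-prime : ∀ {q} → Prime q → ¬ q ∣ |B| → Tiles (q * s)
    dilate-prime {q@(suc q′)} q-prime q∤|B| = reps-pos⇒tiles (q * s) (tiles⇒|A||B|≡M s tiles) reps-pos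
      where
      |B|^q′≡reps : ∀ c → |B| ^ q′ ≡ reps (q * s) c [mod q ]
      |B|^q′≡reps c = subst (_≡ reps (q * s) c [mod q ]) (tuples-count q′ c)
        (≡mod-Σ< M (λ a → χA a * eval (P ^ₚ q) (hits a c)) _ λ a _ → ≡mod-*ˡ (χA a)
          (≡mod-trans (frobenius q-prime M χB (λ b → s * b) χB≤1 (hits a c))
            (≡mod-reflexive (Σ<-ext M (λ b → cong (χB b *_) (𝟙-≡0-cong (cong (_% M) (shuffle a c b))))))))
        where
        shuffle′ : ∀ a c b q s → a + c + q * (s * b) ≡ a + q * s * b + c
        shuffle′ = solve-∀
        shuffle : ∀ a c b → a + c + q * (s * b) ≡ a + q * s * b + c
        shuffle a c b = shuffle′ a c b q s
      q∤|B|^ : ∀ j → ¬ q ∣ |B| ^ j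
      q∤|B|^ zero    = prime∤1 q-prime
      q∤|B|^ (suc j) q∣ with euclidsLemma |B| (|B| ^ j) q-prime q∣
      ... | inj₁ q∣|B|   = q∤|B| q∣|B|
      ... | inj₂ q∣|B|^j = q∤|B|^ j q∣|B|^j
      reps-pos : ∀ c → c < M → 1 ≤ reps (q * s) c
      reps-pos c _ with reps (q * s) c in e
      ... | suc _ = s≤s z≤n
      ... | zero  = ⊥-elim (q∤|B|^ q′ (≡mod-resp-∣ ∣-refl
        (subst (_≡ |B| ^ q′ [mod q ]) e (≡mod-sym (|B|^q′≡reps c))) (q ∣0)))

  -- Tijdeman's dilation theorem, one prime factor of s at a time.
  tiles-dilate : Tiles 1 → ∀ s → gcd s M ≡ 1 → Tiles s
  tiles-dilate tiles₁ = <-rec _ dilate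
    where
    |A||B|≡M : |A| * |B| ≡ M
    |A||B|≡M = tiles⇒|A||B|≡M 1 tiles₁
    dilate : ∀ s → (∀ {s′} → s′ < s → gcd s′ M ≡ 1 → Tiles s′) → gcd s M ≡ 1 → Tiles s
    dilate zero _ M≡1 c = begin
      reps 0 c                                     ≡⟨ Σ<-ext M (λ a → cong (χA a *_) (Σ<-ext M (λ b →
                                                        cong (χB b *_) (𝟙-yes (_ ≟ 0) (n<1⇒n≡0 (%M<1 (a + 0 * b + c)))))))  ⟩
      Σ< M (λ a → χA a * Σ< M (λ b → χB b * 1))    ≡⟨ Σ<-ext M (λ a → cong (χA a *_) (Σ<-ext M (λ b → *-identityʳ (χB b)))) ⟩
      Σ< M (λ a → χA a * |B|)                      ≡⟨ Σ<-*ʳ M |B| χA ⟩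
      |A| * |B|                                    ≡⟨ |A||B|≡M ⟩
      M                                            ≡⟨ M≡1 ⟩
      1                                            ∎
      where
      open ≡-Reasoning
      %M<1 : ∀ x → x % M < 1
      %M<1 x = subst (x % M <_) M≡1 (m%n<n x M)
    dilate 1 _ _ = tiles₁
    dilate s@(2+ _) smaller gs with prime-divisor s (s≤s (s≤s z≤n))
    ... | q , q-prime , divides s′ s≡s′q =
      subst Tiles (trans (*-comm q s′) (sym s≡s′q)) (dilate-prime s′ (smaller s′<s gs′) q-prime q∤|B|)
      where
      instance _ = prime⇒nonTrivial q-prime
      s′<s : s′ < s
      s′<s = subst (s′ <_) (sym s≡s′q) (m<m*n s′ q {{≢-nonZero λ { refl → case s≡s′q of λ () }}} (nonTrivial⇒n>1 q))
      gs′ : gcd s′ M ≡ 1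
      gs′ = ∣1⇒≡1 (subst (gcd s′ M ∣_) gs
        (gcd-greatest (∣-trans (gcd[m,n]∣m s′ M) (divides q (trans s≡s′q (*-comm s′ q)))) (gcd[m,n]∣n s′ M)))
      q∤|B| : ¬ q ∣ |B|
      q∤|B| q∣|B| = prime∤1 q-prime (subst (q ∣_) gs
        (gcd-greatest (divides s′ s≡s′q) (∣-trans q∣|B| (divides |A| (sym |A||B|≡M)))))

-- Counting units in a fibre

totient : ℕ → ℕ
totient n = Σ< n (λ k → 𝟙 (gcd k n ≟ 1))

module UnitFibres (m : ℕ) where

  M : ℕ
  M = suc m

  isUnit : ℕ → ℕ
  isUnit h = 𝟙 (gcd h M ≟ 1)

  isUnit-*ˡ : ∀ {l} h → gcd l M ≡ 1 → isUnit ((l * h) % M) ≡ isUnit h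
  isUnit-*ˡ {l} h gl =
    cong (λ g → 𝟙 (g ≟ 1)) (trans (sym (gcd-≡mod (≡mod-% M (l * h)))) (gcd-*-unitˡ {l} h gl))

  Σ<-reindex-unit : ∀ {l} → gcd l M ≡ 1 → ∀ F → Σ< M (λ h → F ((l * h) % M)) ≡ Σ< M F
  Σ<-reindex-unit {l} gl F with unit⇒inverse {l} {M} (s≤s z≤n) gl
  ... | μ , lμ≡1 = begin
    Σ< M (λ h → F ((l * h) % M))
      ≡⟨ Σ<-ext M (λ h → sym (Σ<-delta M ((l * h) % M) F (m%n<n (l * h) M))) ⟩
    Σ< M (λ h → Σ< M (λ j → 𝟙 ((l * h) % M ≟ j) * F j))
      ≡⟨ Σ<-comm M M (λ h j → 𝟙 ((l * h) % M ≟ j) * F j) ⟩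
    Σ< M (λ j → Σ< M (λ h → 𝟙 ((l * h) % M ≟ j) * F j))
      ≡⟨ Σ<-cong M (λ j j<M → trans (Σ<-*ʳ M (F j) (λ h → 𝟙 ((l * h) % M ≟ j)))
           (trans (cong (_* F j) (preimage j j<M)) (*-identityˡ (F j)))) ⟩
    Σ< M F ∎
    where
    open ≡-Reasoning
    preimage : ∀ j → j < M → Σ< M (λ h → 𝟙 ((l * h) % M ≟ j)) ≡ 1
    preimage j j<M = Σ<-𝟙-unique M h₀ (λ h → (l * h) % M ≟ j) (m%n<n (μ * j) M) lh₀≡j unique
      where
      h₀ = (μ * j) % M
      lh₀≡j : (l * h₀) % M ≡ j
      lh₀≡j = trans (≡mod⇒%≡ M (≡mod-trans (≡mod-*ˡ l (≡mod-sym (≡mod-% M (μ * j))))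
        (subst (_≡ j [mod M ]) (shuffle j l μ) (≡mod-*-inverse j l μ lμ≡1)))) (m<n⇒m%n≡m j<M)
        where
        shuffle : ∀ j l μ → j * l * μ ≡ l * (μ * j)
        shuffle = solve-∀
      unique : ∀ h → h < M → (l * h) % M ≡ j → h ≡ h₀
      unique h h<M lh≡j = ≡mod⇒≡ M h<M (m%n<n (μ * j) M) (≡mod-cancel-unitˡ l μ lμ≡1
        (%≡⇒≡mod M (trans lh≡j (sym lh₀≡j))))

  unitsAbove : ℕ → ℕ → ℕ
  unitsAbove D t = Σ< M (λ h → isUnit h * 𝟙 (modℕ h D ≟ modℕ t D))

  module _ {D} (D∣M : D ∣ M) (1≤D : 1 ≤ D) where

    -- Multiplication by a unit l of ℤ_M lifting t τ⁻¹ carries the units above τ onto those above t.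
    unitsAbove-invariant : ∀ {τ t} → gcd τ D ≡ 1 → gcd t D ≡ 1 → unitsAbove D τ ≡ unitsAbove D t
    unitsAbove-invariant {τ} {t} gτ gt with unit⇒inverse {τ} 1≤D gτ
    ... | w , τw≡1 with unit-lift {r = t * w} D∣M (gcd-*-units {t} {w} gt (inverse⇒unit τ w τw≡1))
    ...   | l , gl , l≡tw = sym (begin
      unitsAbove D t
        ≡⟨ Σ<-reindex-unit {l} gl (λ h → isUnit h * 𝟙 (modℕ h D ≟ modℕ t D)) ⟨
      Σ< M (λ h → isUnit ((l * h) % M) * 𝟙 (modℕ ((l * h) % M) D ≟ modℕ t D))
        ≡⟨ Σ<-ext M (λ h → cong₂ _*_ (isUnit-*ˡ {l} h gl) (𝟙-cong (_ ≟ _) (_ ≟ _) (to h) (from h))) ⟩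
      unitsAbove D τ ∎)
      where
      open ≡-Reasoning
      lτ≡t : l * τ ≡ t [mod D ]
      lτ≡t = ≡mod-trans (≡mod-*ʳ τ l≡tw) (subst (_≡ t [mod D ]) (shuffle t w τ) (≡mod-*-inverse t τ w τw≡1))
        where
        shuffle : ∀ t w τ → t * τ * w ≡ t * w * τ
        shuffle = solve-∀
      μ : ℕ
      μ = proj₁ (unit⇒inverse {l} 1≤D (gcd-unit-∣ {l} D∣M gl))
      lμ≡1 : l * μ ≡ 1 [mod D ]
      lμ≡1 = proj₂ (unit⇒inverse {l} 1≤D (gcd-unit-∣ {l} D∣M gl))
      reduce : ∀ h → (l * h) % M ≡ l * h [mod D ]
      reduce h = ≡mod-∣ D∣M (≡mod-sym (≡mod-% M (l * h)))
      to : ∀ h → modℕ ((l * h) % M) D ≡ modℕ t D → modℕ h D ≡ modℕ τ D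
      to h e = ≡mod⇒modℕ≡ 1≤D (≡mod-cancel-unitˡ l μ lμ≡1
        (≡mod-trans (≡mod-sym (reduce h)) (≡mod-trans (modℕ≡⇒≡mod 1≤D e) (≡mod-sym lτ≡t))))
      from : ∀ h → modℕ h D ≡ modℕ τ D → modℕ ((l * h) % M) D ≡ modℕ t D
      from h e = ≡mod⇒modℕ≡ 1≤D (≡mod-trans (reduce h) (≡mod-trans (≡mod-*ˡ l (modℕ≡⇒≡mod 1≤D e)) lτ≡t))

    Σ<-unitsAbove : Σ< D (λ τ → 𝟙 (gcd τ D ≟ 1) * unitsAbove D τ) ≡ totient M
    Σ<-unitsAbove = trans (Σ<-comm-weighted D M (λ τ → 𝟙 (gcd τ D ≟ 1)) isUnit (λ τ h → 𝟙 (modℕ h D ≟ modℕ τ D)))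
      (Σ<-ext M below)
      where
      below : ∀ h → isUnit h * Σ< D (λ τ → 𝟙 (gcd τ D ≟ 1) * 𝟙 (modℕ h D ≟ modℕ τ D)) ≡ isUnit h
      below h with gcd h M ≟ 1
      ... | no _   = refl
      ... | yes gh = trans (+-identityʳ _) (trans (Σ<-single D c (modℕ< h 1≤D) other)
        (cong₂ _*_ (𝟙-yes (gcd c D ≟ 1) gc) (𝟙-yes (c ≟ modℕ c D) (sym (modℕ-id (modℕ< h 1≤D))))))
        where
        c = modℕ h D
        gc : gcd c D ≡ 1
        gc = trans (sym (gcd-≡mod (≡modℕ h 1≤D))) (gcd-unit-∣ {h} D∣M gh)
        other : ∀ τ → τ < D → τ ≢ c → 𝟙 (gcd τ D ≟ 1) * 𝟙 (c ≟ modℕ τ D) ≡ 0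
        other τ τ<D τ≢c = trans (cong (𝟙 (gcd τ D ≟ 1) *_) (𝟙-no (c ≟ modℕ τ D)
          (λ e → τ≢c (trans (sym (modℕ-id τ<D)) (sym e))))) (*-zeroʳ (𝟙 (gcd τ D ≟ 1)))

    unitsAbove*totient : ∀ {t} → gcd t D ≡ 1 → unitsAbove D t * totient D ≡ totient M
    unitsAbove*totient {t} gt = sym (begin
      totient M                                          ≡⟨ Σ<-unitsAbove ⟨
      Σ< D (λ τ → 𝟙 (gcd τ D ≟ 1) * unitsAbove D τ)      ≡⟨ Σ<-ext D invariant ⟩
      Σ< D (λ τ → 𝟙 (gcd τ D ≟ 1) * unitsAbove D t)      ≡⟨ Σ<-*ʳ D (unitsAbove D t) (λ τ → 𝟙 (gcd τ D ≟ 1)) ⟩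
      totient D * unitsAbove D t                         ≡⟨ *-comm (totient D) (unitsAbove D t) ⟩
      unitsAbove D t * totient D                         ∎)
      where
      open ≡-Reasoning
      invariant : ∀ τ → 𝟙 (gcd τ D ≟ 1) * unitsAbove D τ ≡ 𝟙 (gcd τ D ≟ 1) * unitsAbove D t
      invariant τ with gcd τ D ≟ 1
      ... | yes gτ = cong (1 *_) (unitsAbove-invariant gτ gt)
      ... | no _   = refl

  solutions : ℕ → ℕ → ℕ → ℕ
  solutions N u v = Σ< M (λ h → isUnit h * 𝟙 (modℕ (h * v) N ≟ u))

  -- For u = u′ c and v = v′ c with u′, v′ units mod D: h v ≡ u (mod c D) iff h ≡ u′ v′⁻¹ (mod D).
  solutions-scaled*totient : ∀ {c D u′ v′} → c * D ∣ M → 1 ≤ c → 1 ≤ D → gcd u′ D ≡ 1 → gcd v′ D ≡ 1 →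
    u′ * c < c * D → solutions (c * D) (u′ * c) (v′ * c) * totient D ≡ totient M
  solutions-scaled*totient {c@(suc _)} {D} {u′} {v′} cD∣M 1≤c 1≤D gu gv u′c<cD with unit⇒inverse {v′} 1≤D gv
  ... | w , v′w≡1 = trans (cong (_* totient D) (Σ<-ext M λ h → cong (isUnit h *_) (𝟙-cong (_ ≟ _) (_ ≟ _) (to h) (from h))))
    (unitsAbove*totient (∣-trans (divides c refl) cD∣M) 1≤D (gcd-*-units {u′} {w} gu (inverse⇒unit v′ w v′w≡1)))
    where
    1≤cD : 1 ≤ c * D
    1≤cD = ≤-trans 1≤D (m≤n*m D c)
    shuffle : ∀ h → h * (v′ * c) ≡ c * (h * v′)
    shuffle h = trans (sym (*-assoc h v′ c)) (*-comm (h * v′) c)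
    to : ∀ h → modℕ (h * (v′ * c)) (c * D) ≡ u′ * c → modℕ h D ≡ modℕ (u′ * w) D
    to h e = ≡mod⇒modℕ≡ 1≤D (≡mod-trans (≡mod-sym (≡mod-*-inverse h v′ w v′w≡1)) (≡mod-*ʳ w hv′≡u′))
      where
      hv′≡u′ : h * v′ ≡ u′ [mod D ]
      hv′≡u′ = ≡mod-unscale {c} (subst₂ (_≡_[mod c * D ]) (shuffle h) (*-comm u′ c)
        (modℕ≡⇒≡mod 1≤cD (trans e (sym (modℕ-id u′c<cD)))))
    from : ∀ h → modℕ h D ≡ modℕ (u′ * w) D → modℕ (h * (v′ * c)) (c * D) ≡ u′ * c
    from h e = trans (≡mod⇒modℕ≡ 1≤cD (subst₂ (_≡_[mod c * D ]) (sym (shuffle h)) (*-comm c u′) (≡mod-scale {c} hv′≡u′)))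
      (modℕ-id u′c<cD)
      where
      hv′≡u′ : h * v′ ≡ u′ [mod D ]
      hv′≡u′ = ≡mod-trans (≡mod-*ʳ v′ (modℕ≡⇒≡mod 1≤D e))
        (subst (_≡ u′ [mod D ]) (shuffle′ u′ w v′) (≡mod-*-inverse u′ v′ w v′w≡1))
        where
        shuffle′ : ∀ u′ w v′ → u′ * v′ * w ≡ u′ * w * v′
        shuffle′ = solve-∀

  solutions*totient : ∀ {N u v D} → N ∣ M → u < N → v < N → gcd u N ≡ gcd v N → N ≡ gcd v N * D →
    solutions N u v * totient D ≡ totient M
  solutions*totient {N} {u} {v} {D} N∣M u<N v<N gu≡gv N≡cD
    with gcd[m,n]∣m v N | subst (_∣ u) gu≡gv (gcd[m,n]∣m u N)
  ... | divides v′ v≡v′c | divides u′ u≡u′c =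
    trans (cong (λ (N , u , v) → solutions N u v * totient D) (cong₂ _,_ N≡cD (cong₂ _,_ u≡u′c v≡v′c)))
      (solutions-scaled*totient {c} {D} {u′} {v′} (subst (_∣ M) N≡cD N∣M) 1≤c 1≤D (coprime-part u′ u≡u′c gu≡gv)
        (coprime-part v′ v≡v′c refl) (subst₂ _<_ u≡u′c N≡cD u<N))
    where
    c = gcd v N
    1≤N : 1 ≤ N
    1≤N = ≤-trans (s≤s z≤n) u<N
    c≢0 : c ≢ 0
    c≢0 c≡0 = <⇒≱ 1≤N (≤-reflexive (gcd[m,n]≡0⇒n≡0 v c≡0))
    1≤c : 1 ≤ c
    1≤c = n≢0⇒n>0 c≢0
    1≤D : 1 ≤ D
    1≤D = n≢0⇒n>0 λ D≡0 → <⇒≱ 1≤N (≤-reflexive (trans N≡cD (trans (cong (c *_) D≡0) (*-zeroʳ c))))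
    instance
      c-nonZero : NonZero c
      c-nonZero = ≢-nonZero c≢0
    coprime-part : ∀ {x} x′ → x ≡ x′ * c → gcd x N ≡ c → gcd x′ D ≡ 1
    coprime-part {x} x′ x≡x′c gx≡c = *-cancelˡ-≡ _ 1 c (begin
      c * gcd x′ D        ≡⟨ c*gcd[m,n]≡gcd[cm,cn] c x′ D ⟩
      gcd (c * x′) (c * D) ≡⟨ cong₂ gcd (trans (*-comm c x′) (sym x≡x′c)) (sym N≡cD) ⟩
      gcd x N              ≡⟨ gx≡c ⟩
      c                    ≡⟨ *-identityʳ c ⟨
      c * 1                ∎)
      where open ≡-Reasoning

  solutions-gcd≢ : ∀ {N u v} → N ∣ M → 1 ≤ N → gcd u N ≢ gcd v N → solutions N u v ≡ 0
  solutions-gcd≢ {N} {u} {v} N∣M 1≤N gu≢gv = Σ<-zero M none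
    where
    none : ∀ h → h < M → isUnit h * 𝟙 (modℕ (h * v) N ≟ u) ≡ 0
    none h _ with gcd h M ≟ 1
    ... | no _  = refl
    ... | yes gh with modℕ (h * v) N ≟ u
    ...   | no _  = refl
    ...   | yes e = ⊥-elim (gu≢gv (begin
      gcd u N              ≡⟨ cong (λ z → gcd z N) e ⟨
      gcd (modℕ (h * v) N) N ≡⟨ gcd-≡mod (≡modℕ (h * v) 1≤N) ⟨
      gcd (h * v) N        ≡⟨ gcd-*-unitˡ {h} v (gcd-unit-∣ {h} N∣M gh) ⟩
      gcd v N              ∎))
      where open ≡-Reasoning

diffMod-+ : ∀ {N} x a → 1 ≤ N → diffMod N x (modℕ a N) + a ≡ x [mod N ]
diffMod-+ {N} x a 1≤N = ≡mod-trans (≡mod-+ (≡mod-sym (≡modℕ (modℕ x N + N ∸ r) 1≤N)) (≡modℕ a 1≤N))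
  (subst (_≡ x [mod N ]) (sym (m∸n+n≡m r≤)) (subst (modℕ x N + N ≡_[mod N ]) (+-identityʳ x)
    (≡mod-+ (≡mod-sym (≡modℕ x 1≤N)) ≡mod-self)))
  where
  r = modℕ a N
  r≤ : r ≤ modℕ x N + N
  r≤ = ≤-trans (<⇒≤ (modℕ< a 1≤N)) (m≤n+m N (modℕ x N))

diffMod< : ∀ {N} x z → 1 ≤ N → diffMod N x z < N
diffMod< {N} x z 1≤N = modℕ< (modℕ x N + N ∸ z) 1≤N

-- Modulo any N ∣ m + 1, the number m is -1.
module MinusOne (m : ℕ) {N : ℕ} (N∣1+m : N ∣ suc m) where

  z+m*z≡0 : ∀ z → z + m * z ≡ 0 [mod N ]
  z+m*z≡0 z = ≡mod-∣ N∣1+m (by 0 z (expand m z))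
    where
    expand : ∀ m z → z + m * z + 0 * suc m ≡ 0 + z * suc m
    expand = solve-∀

  m*[m*z]≡z : ∀ z → m * (m * z) ≡ z [mod N ]
  m*[m*z]≡z z = ≡mod-trans
    (subst₂ (_≡_[mod N ]) (+-identityʳ (m * (m * z))) (shuffle m z)
      (≡mod-+ (≡mod-refl {a = m * (m * z)}) (≡mod-sym (z+m*z≡0 z))))
    (≡mod-+ (z+m*z≡0 (m * z)) (≡mod-refl {a = z}))
    where
    shuffle : ∀ m z → m * (m * z) + (z + m * z) ≡ m * z + m * (m * z) + z
    shuffle = solve-∀

  -- With s = -h and c = h y - x we get a + s b + c = h (y - b) - (x - a).
  module Residues (1≤N : 1 ≤ N) (x y h : ℕ) where

    s c : ℕ
    s = m * h
    c = m * (x + s * y)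

    residues : ∀ a b → a + s * b + c + diffMod N x (modℕ a N) ≡ h * diffMod N y (modℕ b N) [mod N ]
    residues a b = ≡mod-cancelʳ-+ (h * b) (≡mod-trans lhs (≡mod-sym rhs))
      where
      dA = diffMod N x (modℕ a N)
      dB = diffMod N y (modℕ b N)
      shuffle : ∀ a b x y h m dA → a + m * h * b + m * (x + m * h * y) + dA + h * b
                                 ≡ (dA + a + m * x) + (h * b + m * (h * b)) + m * (m * (h * y))
      shuffle = solve-∀
      lhs : a + s * b + c + dA + h * b ≡ h * y [mod N ]
      lhs = subst (_≡ h * y [mod N ]) (sym (shuffle a b x y h m dA))
        (≡mod-+ (≡mod-+ (≡mod-trans (≡mod-+ (diffMod-+ x a 1≤N) (≡mod-refl {a = m * x})) (z+m*z≡0 x))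
                        (z+m*z≡0 (h * b)))
                (m*[m*z]≡z (h * y)))
      rhs : h * dB + h * b ≡ h * y [mod N ]
      rhs = subst (_≡ h * y [mod N ]) (*-distribˡ-+ h dB b) (≡mod-*ˡ h (diffMod-+ y b 1≤N))

    𝟙-residues : ∀ a b → 𝟙 (modℕ (h * diffMod N y (modℕ b N)) N ≟ diffMod N x (modℕ a N))
                       ≡ 𝟙 (modℕ (a + s * b + c) N ≟ 0)
    𝟙-residues a b = 𝟙-cong (_ ≟ _) (_ ≟ _) to from
      where
      dA = diffMod N x (modℕ a N)
      dA-id : modℕ dA N ≡ dA
      dA-id = modℕ-id (diffMod< x (modℕ a N) 1≤N)
      to : modℕ (h * diffMod N y (modℕ b N)) N ≡ dA → modℕ (a + s * b + c) N ≡ 0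
      to e = trans (≡mod⇒modℕ≡ 1≤N (≡mod-cancelʳ-+ dA (≡mod-trans (residues a b)
        (modℕ≡⇒≡mod 1≤N (trans e (sym dA-id)))))) (modℕ-id 1≤N)
      from : modℕ (a + s * b + c) N ≡ 0 → modℕ (h * diffMod N y (modℕ b N)) N ≡ dA
      from e = trans (≡mod⇒modℕ≡ 1≤N (≡mod-trans (≡mod-sym (residues a b))
        (≡mod-+ (modℕ≡⇒≡mod 1≤N (trans e (sym (modℕ-id 1≤N)))) (≡mod-refl {a = dA})))) dA-id

𝟙-∣-lifts : ∀ {N K} M .{{_ : NonZero M}} → N * K ≡ M → ∀ z →
  𝟙 (modℕ z N ≟ 0) ≡ Σ< K (λ t → 𝟙 ((z + t * N) % M ≟ 0))
𝟙-∣-lifts {N} {K} M NK≡M z with modℕ z N ≟ 0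
... | no z≢0 = sym (Σ<-zero K λ t _ → 𝟙-no (_ ≟ 0) λ lift≡0 → z≢0 (trans (≡mod⇒modℕ≡ 1≤N
  (≡mod-cancelʳ-+ (t * N) (≡mod-trans (≡mod-∣ N∣M (%≡0⇒≡mod M lift≡0)) (≡mod-sym (k*N≡0 t)))))
  (modℕ-id 1≤N)))
  where
  1≤N : 1 ≤ N
  1≤N = n≢0⇒n>0 λ { refl → ≢-nonZero⁻¹ M (sym NK≡M) }
  N∣M : N ∣ M
  N∣M = divides K (trans (sym NK≡M) (*-comm N K))
... | yes z≡0 = sym (Σ<-𝟙-unique K t₀ (λ t → (z + t * N) % M ≟ 0) t₀<K (≡mod⇒%≡0 M z+t₀N≡0) unique)
  where
  1≤N : 1 ≤ N
  1≤N = n≢0⇒n>0 λ { refl → ≢-nonZero⁻¹ M (sym NK≡M) }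
  1≤K : 1 ≤ K
  1≤K = n≢0⇒n>0 λ { refl → ≢-nonZero⁻¹ M (trans (sym NK≡M) (*-zeroʳ N)) }
  instance
    N-nonZero : NonZero N
    N-nonZero = >-nonZero 1≤N
  N∣M : N ∣ M
  N∣M = divides K (trans (sym NK≡M) (*-comm N K))
  N∣z%M : N ∣ z % M
  N∣z%M = ≡mod-resp-∣ ∣-refl
    (≡mod-trans (≡mod-sym (modℕ≡⇒≡mod 1≤N (trans z≡0 (sym (modℕ-id 1≤N))))) (≡mod-∣ N∣M (≡mod-% M z))) (N ∣0)
  j = quotient N∣z%M
  j<K : j < K
  j<K = *-cancelʳ-< N j K (subst₂ _<_ (_∣_.equality N∣z%M) (trans (sym NK≡M) (*-comm N K)) (m%n<n z M))
  t₀ = modℕ (K ∸ j) K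
  t₀<K : t₀ < K
  t₀<K = modℕ< (K ∸ j) 1≤K
  t₀N≡[K∸j]N : t₀ * N ≡ (K ∸ j) * N [mod M ]
  t₀N≡[K∸j]N = subst (λ M → t₀ * N ≡ (K ∸ j) * N [mod M ]) NK≡M (subst₂ (_≡_[mod N * K ]) (*-comm N t₀) (*-comm N (K ∸ j))
    (≡mod-scale {N} (≡mod-sym (≡modℕ (K ∸ j) 1≤K))))
  z+t₀N≡0 : z + t₀ * N ≡ 0 [mod M ]
  z+t₀N≡0 = ≡mod-trans (≡mod-+ (subst (z ≡_[mod M ]) (_∣_.equality N∣z%M) (≡mod-% M z)) t₀N≡[K∸j]N)
    (subst (_≡ 0 [mod M ]) (sym jN+[K∸j]N≡M) ≡mod-self)
    where
    jN+[K∸j]N≡M : j * N + (K ∸ j) * N ≡ M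
    jN+[K∸j]N≡M = trans (sym (*-distribʳ-+ N j (K ∸ j)))
      (trans (cong (_* N) (m+[n∸m]≡n (<⇒≤ j<K))) (trans (*-comm K N) NK≡M))
  unique : ∀ t → t < K → (z + t * N) % M ≡ 0 → t ≡ t₀
  unique t t<K lift≡0 = ≡mod⇒≡ K {{>-nonZero 1≤K}} t<K t₀<K (≡mod-unscale {N}
    (subst₂ (_≡_[mod N * K ]) (*-comm t N) (*-comm t₀ N) (subst (t * N ≡ t₀ * N [mod_]) (sym NK≡M)
      (≡mod-cancelʳ-+ z (subst₂ (_≡_[mod M ]) (+-comm z (t * N)) (+-comm z (t₀ * N))
        (≡mod-trans (%≡0⇒≡mod M lift≡0) (≡mod-sym z+t₀N≡0)))))))

χ : ∀ {n} → Subset n → ℕ → ℕ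
χ []            _       = 0
χ (_ ∷ A)       (suc k) = χ A k
χ (inside ∷ _)  zero    = 1
χ (outside ∷ _) zero    = 0

χ≤1 : ∀ {n} (A : Subset n) k → χ A k ≤ 1
χ≤1 []            _       = z≤n
χ≤1 (_ ∷ A)       (suc k) = χ≤1 A k
χ≤1 (inside ∷ _)  zero    = s≤s z≤n
χ≤1 (outside ∷ _) zero    = z≤n

∣∣≡Σ<χ : ∀ {n} (A : Subset n) → ∣ A ∣ ≡ Σ< n (χ A)
∣∣≡Σ<χ []            = refl
∣∣≡Σ<χ (inside ∷ A)  = cong suc (∣∣≡Σ<χ A)
∣∣≡Σ<χ (outside ∷ A) = ∣∣≡Σ<χ A

𝟙∈?≡χ : ∀ {n} (i : Fin n) (A : Subset n) → 𝟙 (i ∈? A) ≡ χ A (toℕ i)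
𝟙∈?≡χ Fin.zero    (inside ∷ A)  = refl
𝟙∈?≡χ Fin.zero    (outside ∷ A) = 𝟙-no (Fin.zero ∈? outside ∷ A) λ ()
𝟙∈?≡χ (Fin.suc i) (x ∷ A)       = trans (𝟙-cong (Fin.suc i ∈? x ∷ A) (i ∈? A) drop-there there) (𝟙∈?≡χ i A)

∈⇒χ≡1 : ∀ {n} {i : Fin n} {A : Subset n} → i ∈ A → χ A (toℕ i) ≡ 1
∈⇒χ≡1 {i = i} {A} i∈A = trans (sym (𝟙∈?≡χ i A)) (𝟙-yes (i ∈? A) i∈A)

χ≥1⇒∈ : ∀ {n} {A : Subset n} k (k<n : k < n) → 1 ≤ χ A k → fromℕ< k<n ∈ A
χ≥1⇒∈ {A = A} k k<n χ≥1 =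
  𝟙-pos (fromℕ< k<n ∈? A) (subst (1 ≤_) (sym (trans (𝟙∈?≡χ (fromℕ< k<n) A) (cong (χ A) (toℕ-fromℕ< k<n)))) χ≥1)

length-filter : ∀ {A : Set} {P : A → Set} (P? : ∀ a → Dec (P a)) xs →
  length (filter P? xs) ≡ sum (map (λ a → 𝟙 (P? a)) xs)
length-filter P? []       = refl
length-filter P? (x ∷ xs) with P? x
... | yes _ = cong suc (length-filter P? xs)
... | no _  = length-filter P? xs

sum-filter : ∀ {A : Set} {P : A → Set} (P? : ∀ a → Dec (P a)) (F : A → ℕ) xs →
  sum (map F (filter P? xs)) ≡ sum (map (λ a → 𝟙 (P? a) * F a) xs)
sum-filter P? F []       = refl
sum-filter P? F (x ∷ xs) with P? x
... | yes _ = cong₂ _+_ (sym (+-identityʳ (F x))) (sum-filter P? F xs)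
... | no _  = sum-filter P? F xs

sum-applyUpTo : ∀ (H g : ℕ → ℕ) n → sum (map H (applyUpTo g n)) ≡ Σ< n (λ k → H (g k))
sum-applyUpTo H g zero    = refl
sum-applyUpTo H g (suc n) = cong (H (g 0) +_) (sum-applyUpTo H (λ k → g (suc k)) n)

sum-allFin : ∀ n (h : Fin n → ℕ) (H : ℕ → ℕ) → (∀ i → h i ≡ H (toℕ i)) → sum (map h (allFin n)) ≡ Σ< n H
sum-allFin n h H h≗H = go n (λ i → i) H h≗H
  where
  go : ∀ n (g : Fin n → Fin _) (H : ℕ → ℕ) → (∀ i → h (g i) ≡ H (toℕ i)) → sum (map h (tabulate g)) ≡ Σ< n H
  go zero    g H eq = refl
  go (suc n) g H eq = cong₂ _+_ (eq Fin.zero) (go n (λ i → g (Fin.suc i)) (λ k → H (suc k)) (λ i → eq (Fin.suc i)))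

w≡Σ< : ∀ {M} (A : Subset M) N z → w A N z ≡ Σ< M (λ k → χ A k * 𝟙 (modℕ k N ≟ z))
w≡Σ< {M} A N z = begin
  length (filter (λ a → modℕ (toℕ a) N ≟ z) (filter (_∈? A) (allFin M)))
    ≡⟨ length-filter (λ a → modℕ (toℕ a) N ≟ z) (filter (_∈? A) (allFin M)) ⟩
  sum (map (λ a → 𝟙 (modℕ (toℕ a) N ≟ z)) (filter (_∈? A) (allFin M)))
    ≡⟨ sum-filter (_∈? A) (λ a → 𝟙 (modℕ (toℕ a) N ≟ z)) (allFin M) ⟩
  sum (map (λ a → 𝟙 (a ∈? A) * 𝟙 (modℕ (toℕ a) N ≟ z)) (allFin M))
    ≡⟨ sum-allFin M _ (λ k → χ A k * 𝟙 (modℕ k N ≟ z)) (λ i → cong (_* 𝟙 (modℕ (toℕ i) N ≟ z)) (𝟙∈?≡χ i A)) ⟩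
  Σ< M (λ k → χ A k * 𝟙 (modℕ k N ≟ z)) ∎
  where open ≡-Reasoning

boxOf≡Σ< : ∀ {M} (A : Subset M) N (x : Fin M) c → 1 ≤ N →
  boxOf A N x c ≡ Σ< M (λ k → χ A k * 𝟙 (gcd (diffMod N (toℕ x) (modℕ k N)) N ≟ c))
boxOf≡Σ< {M} A N x c 1≤N = begin
  sum (map (w A N) (filter (λ z → I z ≟ c) (upTo N)))
    ≡⟨ sum-filter (λ z → I z ≟ c) (w A N) (upTo N) ⟩
  sum (map (λ z → 𝟙 (I z ≟ c) * w A N z) (upTo N))
    ≡⟨ sum-applyUpTo (λ z → 𝟙 (I z ≟ c) * w A N z) (λ z → z) N ⟩
  Σ< N (λ z → 𝟙 (I z ≟ c) * w A N z)
    ≡⟨ Σ<-ext N (λ z → cong (𝟙 (I z ≟ c) *_) (w≡Σ< A N z)) ⟩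
  Σ< N (λ z → 𝟙 (I z ≟ c) * Σ< M (λ k → χ A k * 𝟙 (modℕ k N ≟ z)))
    ≡⟨ Σ<-comm-weighted N M (λ z → 𝟙 (I z ≟ c)) (χ A) (λ z k → 𝟙 (modℕ k N ≟ z)) ⟩
  Σ< M (λ k → χ A k * Σ< N (λ z → 𝟙 (I z ≟ c) * 𝟙 (modℕ k N ≟ z)))
    ≡⟨ Σ<-ext M (λ k → cong (χ A k *_) (trans (Σ<-ext N (λ z → *-comm (𝟙 (I z ≟ c)) (𝟙 (modℕ k N ≟ z))))
         (Σ<-delta N (modℕ k N) (λ z → 𝟙 (I z ≟ c)) (modℕ< k 1≤N)))) ⟩
  Σ< M (λ k → χ A k * 𝟙 (I (modℕ k N) ≟ c)) ∎
  where
  open ≡-Reasoning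
  I : ℕ → ℕ
  I z = gcd (diffMod N (toℕ x) z) N

φ≡totient : ∀ n → φ n ≡ totient n
φ≡totient n = begin
  length (filter (λ k → gcd k n ≟ 1) (map suc (upTo n)))   ≡⟨ length-filter (λ k → gcd k n ≟ 1) (map suc (upTo n)) ⟩
  sum (map U (map suc (upTo n)))                            ≡⟨ cong sum (map-∘ (upTo n)) ⟨
  sum (map (λ k → U (suc k)) (upTo n))                      ≡⟨ sum-applyUpTo (λ k → U (suc k)) (λ k → k) n ⟩
  Σ< n (λ k → U (suc k))                                    ≡⟨ +-cancelˡ-≡ (U 0) _ _ shift ⟩
  totient n                                                 ∎
  where
  open ≡-Reasoning
  U : ℕ → ℕ
  U k = 𝟙 (gcd k n ≟ 1)
  -- gcd n n = n = gcd 0 n, so the count over 1 … n equals the count over 0 … n - 1.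
  gcd[n,n]≡gcd[0,n] : gcd n n ≡ gcd 0 n
  gcd[n,n]≡gcd[0,n] = trans (∣-antisym (gcd[m,n]∣m n n) (gcd-greatest ∣-refl ∣-refl)) (sym (gcd-identityˡ n))
  shift : U 0 + Σ< n (λ k → U (suc k)) ≡ U 0 + totient n
  shift = begin
    Σ< (suc n) U          ≡⟨ Σ<-init-last n U ⟩
    totient n + U n       ≡⟨ cong (λ g → totient n + 𝟙 (g ≟ 1)) gcd[n,n]≡gcd[0,n] ⟩
    totient n + U 0       ≡⟨ +-comm (totient n) (U 0) ⟩
    U 0 + totient n       ∎

module _ where
  open import Data.Integer as ℤ using (+_)
  import Data.Integer.Properties as ℤ

  frac-cross : ∀ a b d e → a * e ≡ b * d → 1 ≤ d → 1 ≤ e → frac a d ≡ frac b e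
  frac-cross a b (suc d) (suc e) eq _ _ = ℚ.fromℚᵘ-cong {mkℚᵘ (+ a) d} {mkℚᵘ (+ b) e}
    (*≡* (trans (sym (ℤ.pos-* a (suc e))) (trans (cong +_ eq) (ℤ.pos-* b (suc d)))))

  frac-+ : ∀ a b d → frac a (suc d) ℚ+ frac b (suc d) ≡ frac (a + b) (suc d)
  frac-+ a b d = ℚ.toℚᵘ-injective (ℚᵘ.≃-trans (ℚ.toℚᵘ-homo-+ (frac a D) (frac b D))
    (ℚᵘ.≃-trans (ℚᵘ.+-cong (ℚ.toℚᵘ-fromℚᵘ (mkℚᵘ (+ a) d)) (ℚ.toℚᵘ-fromℚᵘ (mkℚᵘ (+ b) d)))
      (ℚᵘ.≃-trans (*≡* cross) (ℚᵘ.≃-sym (ℚ.toℚᵘ-fromℚᵘ (mkℚᵘ (+ (a + b)) d))))))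
    where
    D = suc d
    cross : (+ a ℤ.* + D ℤ.+ + b ℤ.* + D) ℤ.* + D ≡ + (a + b) ℤ.* + (D * D)
    cross = begin
      (+ a ℤ.* + D ℤ.+ + b ℤ.* + D) ℤ.* + D  ≡⟨ cong (ℤ._* + D) (cong₂ ℤ._+_ (ℤ.pos-* a D) (ℤ.pos-* b D)) ⟨
      (+ (a * D) ℤ.+ + (b * D)) ℤ.* + D      ≡⟨ cong (ℤ._* + D) (ℤ.pos-+ (a * D) (b * D)) ⟨
      + (a * D + b * D) ℤ.* + D              ≡⟨ ℤ.pos-* (a * D + b * D) D ⟨
      + ((a * D + b * D) * D)                ≡⟨ cong +_ (shuffle a b D) ⟩
      + ((a + b) * (D * D))                  ≡⟨ ℤ.pos-* (a + b) (D * D) ⟩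
      + (a + b) ℤ.* + (D * D)                ∎
      where
      open ≡-Reasoning
      shuffle : ∀ a b D → (a * D + b * D) * D ≡ (a + b) * (D * D)
      shuffle = solve-∀

frac-injective : ∀ a b d e → frac a d ≡ frac b e → 1 ≤ d → 1 ≤ e → a * e ≡ b * d
frac-injective a b (suc d) (suc e) eq _ _ = ℚ.normalize-injective-≃ a b (suc d) (suc e) eq

frac-*ʳ : ∀ a k d e → k * d ≡ e → 1 ≤ e → frac a d ≡ frac (a * k) e
frac-*ʳ a k zero    e kd≡e 1≤e = ⊥-elim (<⇒≱ 1≤e (≤-reflexive (trans (sym kd≡e) (*-zeroʳ k))))
frac-*ʳ a k (suc d) e kd≡e 1≤e =
  frac-cross a (a * k) (suc d) e (trans (cong (a *_) (sym kd≡e)) (sym (*-assoc a k (suc d)))) (s≤s z≤n) 1≤e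

sum-frac : ∀ {A : Set} {P : A → Set} (P? : ∀ c → Dec (P c)) (T : A → ℚ) (Z : A → ℕ) e → 1 ≤ e → ∀ xs →
  (∀ c → P c → T c ≡ frac (Z c) e) →
  foldr ℚ._+_ 0ℚ (map T (filter P? xs)) ≡ frac (sum (map Z (filter P? xs))) e
sum-frac P? T Z (suc d) _ [] _ = sym (frac-cross 0 0 (suc d) 1 refl (s≤s z≤n) (s≤s z≤n))
sum-frac P? T Z (suc d) 1≤e (x ∷ xs) T≡Z/e with P? x
... | yes Px = trans (cong₂ ℚ._+_ (T≡Z/e x Px) (sum-frac P? T Z (suc d) 1≤e xs T≡Z/e)) (frac-+ (Z x) (sum (map Z (filter P? xs))) d)
... | no _   = sum-frac P? T Z (suc d) 1≤e xs T≡Z/e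

-- The box product

module BoxProduct (m : ℕ) (A B : Subset (suc m)) where

  open UnitFibres m

  χA χB : ℕ → ℕ
  χA = χ A
  χB = χ B

  open Tiling m χA χB (χ≤1 B) hiding (M)

  gcdDiff : ℕ → ℕ → ℕ → ℕ
  gcdDiff N x a = gcd (diffMod N x (modℕ a N)) N

  𝔸 𝔹 : ℕ → ℕ → ℕ → ℕ
  𝔸 N x c = Σ< M (λ a → χA a * 𝟙 (gcdDiff N x a ≟ c))
  𝔹 N y c = Σ< M (λ b → χB b * 𝟙 (gcdDiff N y b ≟ c))

  stabiliser : ℕ → ℕ → ℕ
  stabiliser N c = solutions N (modℕ c N) (modℕ c N)

  -- φ(M) times the box product, since 1 / φ(N / c) = stabiliser N c / φ(M) for c ∣ N.
  boxSum : ℕ → ℕ → ℕ → ℕ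
  boxSum N x y = Σ< N (λ k → 𝟙 (suc k ∣? N) * (𝔸 N x (suc k) * 𝔹 N y (suc k) * stabiliser N (suc k)))

  pairs : ℕ → ℕ → ℕ → ℕ → ℕ
  pairs N x y h = Σ< M (λ a → χA a * Σ< M (λ b → χB b *
    𝟙 (modℕ (h * diffMod N y (modℕ b N)) N ≟ diffMod N x (modℕ a N))))

  1≤totient : 1 ≤ totient M
  1≤totient = ≤-trans (≤-reflexive (sym (𝟙-yes (gcd (1 % M) M ≟ 1) (trans (sym (gcd-≡mod (≡mod-% M 1))) (gcd-zeroˡ M)))))
    (term≤Σ< M (1 % M) (λ k → 𝟙 (gcd k M ≟ 1)) (m%n<n 1 M))

  module _ {N} (N∣M : N ∣ M) (1≤N : 1 ≤ N) where

    stabiliser*totient : ∀ {c} .{{_ : NonZero c}} → c ∣ N → stabiliser N c * totient (N / c) ≡ totient M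
    stabiliser*totient {c} c∣N = solutions*totient N∣M (modℕ< c 1≤N) (modℕ< c 1≤N) refl
      (trans (sym (m*[n/m]≡n c∣N)) (cong (_* (N / c)) (sym gcd[c%N,N]≡c)))
      where
      gcd[c%N,N]≡c : gcd (modℕ c N) N ≡ c
      gcd[c%N,N]≡c = trans (sym (gcd-≡mod (≡modℕ c 1≤N))) (∣-antisym (gcd[m,n]∣m c N) (gcd-greatest ∣-refl c∣N))

    -- Only the divisor c = gcd(x - a, N) contributes; it contributes iff gcd(y - b, N) = c too.
    divisor-sum : ∀ x y a b →
      Σ< N (λ k → 𝟙 (suc k ∣? N) * (𝟙 (gcdDiff N x a ≟ suc k) * 𝟙 (gcdDiff N y b ≟ suc k) * stabiliser N (suc k)))
      ≡ solutions N (diffMod N x (modℕ a N)) (diffMod N y (modℕ b N))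
    divisor-sum x y a b = trans (Σ<-single N (pred c) c-1<N other) (trans (cong term (suc-pred c)) at-c)
      where
      dA = diffMod N x (modℕ a N)
      dB = diffMod N y (modℕ b N)
      c = gcdDiff N x a
      term : ℕ → ℕ
      term c′ = 𝟙 (c′ ∣? N) * (𝟙 (c ≟ c′) * 𝟙 (gcdDiff N y b ≟ c′) * stabiliser N c′)
      instance
        c-nonZero : NonZero c
        c-nonZero = ≢-nonZero (λ c≡0 → <⇒≱ 1≤N (≤-reflexive (gcd[m,n]≡0⇒n≡0 dA c≡0)))
      c∣N : c ∣ N
      c∣N = gcd[m,n]∣n dA N
      c-1<N : pred c < N
      c-1<N = subst (_≤ N) (sym (suc-pred c)) (∣⇒≤ {{>-nonZero 1≤N}} c∣N)
      other : ∀ k → k < N → k ≢ pred c → term (suc k) ≡ 0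
      other k _ k≢ = trans (cong (λ t → 𝟙 (suc k ∣? N) * (t * _ * _)) (𝟙-no (c ≟ suc k) (λ e → k≢ (cong pred (sym e)))))
        (*-zeroʳ (𝟙 (suc k ∣? N)))
      D = N / c
      1≤φD : 1 ≤ totient D
      1≤φD = n≢0⇒n>0 λ φD≡0 → <⇒≱ 1≤totient (≤-reflexive (trans (sym (stabiliser*totient c∣N))
        (trans (cong (stabiliser N c *_) φD≡0) (*-zeroʳ (stabiliser N c)))))
      at-c : term c ≡ solutions N dA dB
      at-c with gcdDiff N y b ≟ c
      ... | no gB≢c = trans (*-annihilate (𝟙 (c ∣? N)) _ (λ _ → cong (_* stabiliser N c) (*-zeroʳ (𝟙 (c ≟ c)))))
        (sym (solutions-gcd≢ N∣M 1≤N (λ e → gB≢c (sym e))))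
      ... | yes gB≡c = begin
        𝟙 (c ∣? N) * (𝟙 (c ≟ c) * 1 * stabiliser N c)
          ≡⟨ cong₂ (λ t t′ → t * (t′ * 1 * stabiliser N c)) (𝟙-yes (c ∣? N) c∣N) (𝟙-yes (c ≟ c) refl) ⟩
        1 * (1 * 1 * stabiliser N c)                    ≡⟨ *-identityˡ _ ⟩
        1 * 1 * stabiliser N c                          ≡⟨ *-identityˡ _ ⟩
        stabiliser N c                                  ≡⟨ *-cancelʳ-≡ _ _ (totient D) {{>-nonZero 1≤φD}} same-product ⟩
        solutions N dA dB                               ∎
        where
        open ≡-Reasoning
        same-product : stabiliser N c * totient D ≡ solutions N dA dB * totient D
        same-product = trans (stabiliser*totient c∣N) (sym (solutions*totient N∣M
          (diffMod< x (modℕ a N) 1≤N) (diffMod< y (modℕ b N) 1≤N) (sym gB≡c)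
          (trans (sym (m*[n/m]≡n c∣N)) (cong (_* D) (sym gB≡c)))))

    boxSum≡Σ<pairs : ∀ x y → boxSum N x y ≡ Σ< M (λ h → isUnit h * pairs N x y h)
    boxSum≡Σ<pairs x y = begin
      boxSum N x y
        ≡⟨ Σ<-ext N (λ k → cong (𝟙 (suc k ∣? N) *_) (expand (suc k))) ⟩
      Σ< N (λ k → 𝟙 (suc k ∣? N) * Σ< M (λ a → χA a * Σ< M (λ b → χB b * E a b (suc k))))
        ≡⟨ Σ<-comm-weighted N M (λ k → 𝟙 (suc k ∣? N)) χA (λ k a → Σ< M (λ b → χB b * E a b (suc k))) ⟩
      Σ< M (λ a → χA a * Σ< N (λ k → 𝟙 (suc k ∣? N) * Σ< M (λ b → χB b * E a b (suc k))))
        ≡⟨ Σ<-ext M (λ a → cong (χA a *_) (Σ<-comm-weighted N M (λ k → 𝟙 (suc k ∣? N)) χB (λ k b → E a b (suc k)))) ⟩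
      Σ< M (λ a → χA a * Σ< M (λ b → χB b * Σ< N (λ k → 𝟙 (suc k ∣? N) * E a b (suc k))))
        ≡⟨ Σ<-ext M (λ a → cong (χA a *_) (Σ<-ext M (λ b → cong (χB b *_) (divisor-sum x y a b)))) ⟩
      Σ< M (λ a → χA a * Σ< M (λ b → χB b * Σ< M (λ h → isUnit h * I h a b)))
        ≡⟨ Σ<-ext M (λ a → cong (χA a *_) (Σ<-comm-weighted M M isUnit χB (λ h b → I h a b))) ⟨
      Σ< M (λ a → χA a * Σ< M (λ h → isUnit h * Σ< M (λ b → χB b * I h a b)))
        ≡⟨ Σ<-comm-weighted M M isUnit χA (λ h a → Σ< M (λ b → χB b * I h a b)) ⟨
      Σ< M (λ h → isUnit h * pairs N x y h) ∎
      where
      open ≡-Reasoning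
      E : ℕ → ℕ → ℕ → ℕ
      E a b c = 𝟙 (gcdDiff N x a ≟ c) * 𝟙 (gcdDiff N y b ≟ c) * stabiliser N c
      I : ℕ → ℕ → ℕ → ℕ
      I h a b = 𝟙 (modℕ (h * diffMod N y (modℕ b N)) N ≟ diffMod N x (modℕ a N))
      expand : ∀ c → 𝔸 N x c * 𝔹 N y c * stabiliser N c ≡ Σ< M (λ a → χA a * Σ< M (λ b → χB b * E a b c))
      expand c = begin
        𝔸 N x c * 𝔹 N y c * stabiliser N c
          ≡⟨ *-assoc (𝔸 N x c) _ _ ⟩
        𝔸 N x c * (𝔹 N y c * stabiliser N c)
          ≡⟨ Σ<-*ʳ M (𝔹 N y c * stabiliser N c) (λ a → χA a * 𝟙 (gcdDiff N x a ≟ c)) ⟨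
        Σ< M (λ a → χA a * 𝟙 (gcdDiff N x a ≟ c) * (𝔹 N y c * stabiliser N c))
          ≡⟨ Σ<-ext M (λ a → trans (*-assoc (χA a) (𝟙 (gcdDiff N x a ≟ c)) (𝔹 N y c * stabiliser N c)) (cong (χA a *_) inner)) ⟩
        Σ< M (λ a → χA a * Σ< M (λ b → χB b * E a b c)) ∎
        where
        inner : ∀ {a} → 𝟙 (gcdDiff N x a ≟ c) * (𝔹 N y c * stabiliser N c) ≡ Σ< M (λ b → χB b * E a b c)
        inner {a} = begin
          p * (𝔹 N y c * stabiliser N c)                               ≡⟨ cong (p *_) (Σ<-*ʳ M (stabiliser N c) (λ b → χB b * 𝟙 (gcdDiff N y b ≟ c))) ⟨
          p * Σ< M (λ b → χB b * 𝟙 (gcdDiff N y b ≟ c) * stabiliser N c) ≡⟨ Σ<-*ˡ M p (λ b → χB b * 𝟙 (gcdDiff N y b ≟ c) * stabiliser N c) ⟨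
          Σ< M (λ b → p * (χB b * 𝟙 (gcdDiff N y b ≟ c) * stabiliser N c)) ≡⟨ Σ<-ext M (λ b → shuffle p (χB b) (𝟙 (gcdDiff N y b ≟ c)) (stabiliser N c)) ⟩
          Σ< M (λ b → χB b * E a b c)                                  ∎
          where
          p = 𝟙 (gcdDiff N x a ≟ c)
          shuffle : ∀ p q r s → p * (q * r * s) ≡ q * (p * r * s)
          shuffle = solve-∀

  gcd[m,M]≡1 : gcd m M ≡ 1
  gcd[m,M]≡1 = ∣1⇒≡1 (∣m+n∣m⇒∣n (subst (gcd m M ∣_) (+-comm 1 m) (gcd[m,n]∣n m M)) (gcd[m,n]∣m m M))

  module _ (tiles : Tiles 1) {N K} (NK≡M : N * K ≡ M) where

    private
      N∣M : N ∣ M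
      N∣M = divides K (trans (sym NK≡M) (*-comm N K))
      1≤N : 1 ≤ N
      1≤N = n≢0⇒n>0 λ { refl → 1+n≢0 (sym NK≡M) }

    -- With s = -h and c = h y - x, the pairs are the representations of 0 modulo N by a + s b + c;
    -- each of them lifts in K ways to ℤ_M, and the dilated tiling A ⊕ s·B counts each lift once.
    pairs≡K : ∀ x y {h} → gcd h M ≡ 1 → pairs N x y h ≡ K
    pairs≡K x y {h} gh = begin
      pairs N x y h
        ≡⟨ Σ<-ext M (λ a → cong (χA a *_) (Σ<-ext M (λ b → cong (χB b *_) (𝟙-residues a b)))) ⟩
      Σ< M (λ a → χA a * Σ< M (λ b → χB b * 𝟙 (modℕ (a + s * b + c) N ≟ 0)))
        ≡⟨ Σ<-ext M (λ a → cong (χA a *_) (Σ<-ext M (λ b → cong (χB b *_) (𝟙-∣-lifts {N} {K} M NK≡M (a + s * b + c))))) ⟩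
      Σ< M (λ a → χA a * Σ< M (λ b → χB b * Σ< K (λ t → hit a b t)))
        ≡⟨ Σ<-ext M (λ a → cong (χA a *_) (Σ<-comm-*ˡ K M χB (λ t b → hit a b t))) ⟨
      Σ< M (λ a → χA a * Σ< K (λ t → Σ< M (λ b → χB b * hit a b t)))
        ≡⟨ Σ<-comm-*ˡ K M χA (λ t a → Σ< M (λ b → χB b * hit a b t)) ⟨
      Σ< K (λ t → Σ< M (λ a → χA a * Σ< M (λ b → χB b * hit a b t)))
        ≡⟨ Σ<-ext K (λ t → Σ<-ext M (λ a → cong (χA a *_) (Σ<-ext M (λ b → cong (χB b *_)
             (𝟙-≡0-cong (cong (_% M) (+-assoc (a + s * b) c (t * N))))))))  ⟩
      Σ< K (λ t → reps s (c + t * N))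
        ≡⟨ Σ<-ext K (λ t → tiles-dilate tiles s (gcd-*-units {m} {h} gcd[m,M]≡1 gh) (c + t * N)) ⟩
      Σ< K (λ _ → 1)
        ≡⟨ trans (Σ<-const K 1) (*-identityʳ K) ⟩
      K ∎
      where
      open ≡-Reasoning
      open MinusOne.Residues m N∣M 1≤N x y h
      hit : ℕ → ℕ → ℕ → ℕ
      hit a b t = 𝟙 ((a + s * b + c + t * N) % M ≟ 0)

    boxSum≡totient*K : ∀ x y → boxSum N x y ≡ totient M * K
    boxSum≡totient*K x y = trans (boxSum≡Σ<pairs N∣M 1≤N x y) (trans (Σ<-ext M each) (Σ<-*ʳ M K isUnit))
      where
      each : ∀ h → isUnit h * pairs N x y h ≡ isUnit h * K
      each h with gcd h M ≟ 1
      ... | yes gh = cong (1 *_) (pairs≡K x y {h} gh)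
      ... | no _   = refl

  boxProduct≡frac : ∀ {N} → N ∣ M → (x y : Fin M) →
    boxProduct N (boxOf A N x) (boxOf B N y) ≡ frac (boxSum N (toℕ x) (toℕ y)) (totient M)
  boxProduct≡frac {N} N∣M x y =
    trans (sum-frac (_∣? N) T Z (totient M) 1≤totient (map suc (upTo N)) T≡Z/φ) (cong (λ z → frac z (totient M)) Σ≡boxSum)
    where
    1≤N : 1 ≤ N
    1≤N = n≢0⇒n>0 λ { refl → 1+n≢0 (trans (_∣_.equality N∣M) (*-zeroʳ (quotient N∣M))) }
    T : ℕ → ℚ
    T c = frac (boxOf A N x c * boxOf B N y c) (φ (quot N c))
    Z′ Z : ℕ → ℕ
    Z′ c = 𝔸 N (toℕ x) c * 𝔹 N (toℕ y) c
    Z c = Z′ c * stabiliser N c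
    T≡Z/φ : ∀ c → c ∣ N → T c ≡ frac (Z c) (totient M)
    T≡Z/φ zero    0∣N = ⊥-elim (<⇒≱ 1≤N (≤-reflexive (0∣⇒≡0 0∣N)))
    T≡Z/φ (suc k) c∣N = trans
      (cong₂ frac (cong₂ _*_ (boxOf≡Σ< A N x (suc k) 1≤N) (boxOf≡Σ< B N y (suc k) 1≤N)) (φ≡totient (N / suc k)))
      (frac-*ʳ (Z′ (suc k)) (stabiliser N (suc k)) (totient (N / suc k)) (totient M) (stabiliser*totient N∣M 1≤N c∣N) 1≤totient)
    Σ≡boxSum : sum (map Z (filter (_∣? N) (map suc (upTo N)))) ≡ boxSum N (toℕ x) (toℕ y)
    Σ≡boxSum = begin
      sum (map Z (filter (_∣? N) (map suc (upTo N))))    ≡⟨ sum-filter (_∣? N) Z (map suc (upTo N)) ⟩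
      sum (map (λ c → 𝟙 (c ∣? N) * Z c) (map suc (upTo N))) ≡⟨ cong sum (map-∘ (upTo N)) ⟨
      sum (map (λ k → 𝟙 (suc k ∣? N) * Z (suc k)) (upTo N)) ≡⟨ sum-applyUpTo (λ k → 𝟙 (suc k ∣? N) * Z (suc k)) (λ k → k) N ⟩
      boxSum N (toℕ x) (toℕ y)                            ∎
      where open ≡-Reasoning

  private
    a+1*b≡a+b : ∀ a b c → a + 1 * b + c ≡ a + b + c
    a+1*b≡a+b a b c = cong (λ t → a + t + c) (*-identityˡ b)

    sum-vanishes : ∀ a b c → (a + 1 * b + c) % M ≡ 0 → a + b + c ≡ 0 [mod M ]
    sum-vanishes a b c hit = subst (_≡ 0 [mod M ]) (a+1*b≡a+b a b c) (%≡0⇒≡mod M hit)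

    M∸c+c≡0 : ∀ c → M ∸ c % M + c ≡ 0 [mod M ]
    M∸c+c≡0 c = ≡mod-trans (≡mod-+ (≡mod-refl {a = M ∸ c % M}) (≡mod-% M c))
      (subst (_≡ 0 [mod M ]) (sym (m∸n+n≡m (m%n≤n c M))) ≡mod-self)

  directSum⇒tiles : DirectSum A B → Tiles 1
  directSum⇒tiles (cover , unique) c with cover (fromℕ< (m%n<n (M ∸ c % M) M))
  ... | a , b , a∈A , b∈B , a+b≡-c = Σ<²-unique M χA χB (λ a b → (a + 1 * b + c) % M ≟ 0) (toℕ a) (toℕ b)
    (toℕ<n a) (toℕ<n b) (∈⇒χ≡1 a∈A) (∈⇒χ≡1 b∈B)
    (trans (cong (_% M) (a+1*b≡a+b (toℕ a) (toℕ b) c)) (≡mod⇒%≡0 M a+b+c≡0)) only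
    where
    a+b+c≡0 : toℕ a + toℕ b + c ≡ 0 [mod M ]
    a+b+c≡0 = ≡mod-trans (≡mod-+ (%≡⇒≡mod M {toℕ a + toℕ b} {M ∸ c % M} (trans a+b≡-c (toℕ-fromℕ< _))) ≡mod-refl) (M∸c+c≡0 c)
    only : ∀ a′ b′ → a′ < M → b′ < M → 1 ≤ χA a′ → 1 ≤ χB b′ → (a′ + 1 * b′ + c) % M ≡ 0 →
      a′ ≡ toℕ a × b′ ≡ toℕ b
    only a′ b′ a′<M b′<M χa′ χb′ hit with unique (χ≥1⇒∈ a′ a′<M χa′) (χ≥1⇒∈ b′ b′<M χb′) a∈A b∈B sums≡
      where
      sums≡ : (toℕ (fromℕ< a′<M) + toℕ (fromℕ< b′<M)) % M ≡ (toℕ a + toℕ b) % M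
      sums≡ rewrite toℕ-fromℕ< a′<M | toℕ-fromℕ< b′<M =
        ≡mod⇒%≡ M (≡mod-cancelʳ-+ c (≡mod-trans (sum-vanishes a′ b′ c hit) (≡mod-sym a+b+c≡0)))
    ... | refl , refl = sym (toℕ-fromℕ< a′<M) , sym (toℕ-fromℕ< b′<M)

  tiles⇒directSum : Tiles 1 → DirectSum A B
  tiles⇒directSum tiles = cover , unique
    where
    cover : (c : Fin M) → ∃[ a ] ∃[ b ] (a ∈ A × b ∈ B × SumsTo a b c)
    cover c with reps-witness 1 (M ∸ toℕ c) (≤-reflexive (sym (tiles (M ∸ toℕ c))))
    ... | a , b , a<M , b<M , χa , χb , hit =
      fromℕ< a<M , fromℕ< b<M , χ≥1⇒∈ a a<M χa , χ≥1⇒∈ b b<M χb ,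
      trans (cong₂ (λ a b → (a + b) % M) (toℕ-fromℕ< a<M) (toℕ-fromℕ< b<M))
        (≡mod⇒≡′ (≡mod-cancelʳ-+ (M ∸ toℕ c) (≡mod-trans (sum-vanishes a b _ hit)
          (≡mod-sym (subst (_≡ 0 [mod M ]) (sym (m+[n∸m]≡n (<⇒≤ (toℕ<n c)))) ≡mod-self)))))
      where
      ≡mod⇒≡′ : ∀ {z} → z ≡ toℕ c [mod M ] → z % M ≡ toℕ c
      ≡mod⇒≡′ z≡c = trans (≡mod⇒%≡ M z≡c) (m<n⇒m%n≡m (toℕ<n c))
    unique : ∀ {a b a′ b′ : Fin M} → a ∈ A → b ∈ B → a′ ∈ A → b′ ∈ B →
      modℕ (toℕ a + toℕ b) M ≡ modℕ (toℕ a′ + toℕ b′) M → a ≡ a′ × b ≡ b′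
    unique {a} {b} {a′} {b′} a∈A b∈B a′∈A b′∈B sums≡ = toℕ-injective a≡a′ , toℕ-injective b≡b′
      where
      c = M ∸ (toℕ a + toℕ b) % M
      inner : ℕ → ℕ
      inner x = Σ< M (λ y → χB y * 𝟙 ((x + 1 * y + c) % M ≟ 0))
      hit : ∀ {x y} → x + y ≡ toℕ a + toℕ b [mod M ] → 1 ≤ χB y → 1 ≤ χB y * 𝟙 ((x + 1 * y + c) % M ≟ 0)
      hit {x} {y} xy≡ab χy = subst (1 ≤_) (sym (cong₂ _*_ (≤-antisym (χ≤1 B y) χy) (𝟙-yes (_ ≟ 0) vanishes))) (s≤s z≤n)
        where
        vanishes : (x + 1 * y + c) % M ≡ 0
        vanishes = trans (cong (_% M) (a+1*b≡a+b x y c)) (≡mod⇒%≡0 M (≡mod-trans (≡mod-+ xy≡ab (≡mod-refl {a = c}))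
          (subst (_≡ 0 [mod M ]) (+-comm c (toℕ a + toℕ b)) (M∸c+c≡0 (toℕ a + toℕ b)))))
      counted : ∀ {x : Fin M} {y : Fin M} → x ∈ A → y ∈ B → toℕ x + toℕ y ≡ toℕ a + toℕ b [mod M ] →
        1 ≤ χA (toℕ x) * inner (toℕ x)
      counted {x} {y} x∈A y∈B xy≡ab = subst (λ t → 1 ≤ t * inner (toℕ x)) (sym (∈⇒χ≡1 x∈A))
        (≤-trans (≤-trans (hit xy≡ab (≤-reflexive (sym (∈⇒χ≡1 y∈B))))
          (term≤Σ< M (toℕ y) (λ y → χB y * 𝟙 ((toℕ x + 1 * y + c) % M ≟ 0)) (toℕ<n y)))
          (≤-reflexive (sym (*-identityˡ (inner (toℕ x))))))
      a′b′≡ab : toℕ a′ + toℕ b′ ≡ toℕ a + toℕ b [mod M ]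
      a′b′≡ab = %≡⇒≡mod M (sym sums≡)
      a≡a′ : toℕ a ≡ toℕ a′
      a≡a′ = Σ<≡1⇒unique M (λ x → χA x * inner x) (tiles c) (toℕ a) (toℕ a′) (toℕ<n a) (toℕ<n a′)
        (counted a∈A b∈B ≡mod-refl) (counted a′∈A b′∈B a′b′≡ab)
      inner≡1 : inner (toℕ a) ≡ 1
      inner≡1 = trans (sym (*-identityˡ _)) (subst (λ t → t * inner (toℕ a) ≡ 1) (∈⇒χ≡1 a∈A)
        (≤-antisym (subst (χA (toℕ a) * inner (toℕ a) ≤_) (tiles c) (term≤Σ< M (toℕ a) (λ x → χA x * inner x) (toℕ<n a)))
                   (counted a∈A b∈B ≡mod-refl)))
      b≡b′ : toℕ b ≡ toℕ b′
      b≡b′ = Σ<≡1⇒unique M (λ y → χB y * 𝟙 ((toℕ a + 1 * y + c) % M ≟ 0)) inner≡1 (toℕ b) (toℕ b′) (toℕ<n b) (toℕ<n b′)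
        (hit ≡mod-refl (≤-reflexive (sym (∈⇒χ≡1 b∈B))))
        (hit (subst (λ t → t + toℕ b′ ≡ toℕ a + toℕ b [mod M ]) (sym a≡a′) a′b′≡ab) (≤-reflexive (sym (∈⇒χ≡1 b′∈B))))

  diffMod-self : ∀ {x} → x < M → diffMod M x (modℕ x M) ≡ 0
  diffMod-self {x} x<M = trans (cong (λ z → (z + M ∸ z) % M) (m<n⇒m%n≡m x<M)) (trans (cong (_% M) (m+n∸m≡n x M)) (n%n≡0 M))

  -- A box product 1 at (x , y) ∈ A × B forces pairs M x y h = 1 for every unit h, and for h = -1
  -- these pairs are the (a , b) ∈ A × B with a + b = x + y.
  box≡1⇒unique-sum : ∀ {x y} → x < M → y < M → 1 ≤ χA x → 1 ≤ χB y → boxSum M x y ≡ totient M →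
    ∀ c → (x + 1 * y + c) % M ≡ 0 → reps 1 c ≡ 1
  box≡1⇒unique-sum {x} {y} x<M y<M χx χy box≡φ c hit = begin
    reps 1 c   ≡⟨ reps-cong (≡mod-sym s≡1) (≡mod-sym c′≡c) ⟩
    reps s c′  ≡⟨ Σ<-ext M (λ a → cong (χA a *_) (Σ<-ext M (λ b → cong (χB b *_) (𝟙-residues a b)))) ⟨
    pairs M x y m ≡⟨ trans (sym (*-identityˡ _))
                       (sym (subst (λ u → u ≡ u * pairs M x y m) unit-m (unit≡unit*pairs m (n<1+n m)))) ⟩
    1 ∎
    where
    open ≡-Reasoning
    open MinusOne m ∣-refl using (z+m*z≡0; m*[m*z]≡z)
    open MinusOne.Residues m ∣-refl (s≤s z≤n) x y m renaming (c to c′)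
    pairs≥1 : ∀ h → 1 ≤ pairs M x y h
    pairs≥1 h = ≤-trans (*-mono-≤ χx inner≥1) (term≤Σ< M x (λ a → χA a * Σ< M (λ b → χB b * I a b)) x<M)
      where
      I : ℕ → ℕ → ℕ
      I a b = 𝟙 (modℕ (h * diffMod M y (modℕ b M)) M ≟ diffMod M x (modℕ a M))
      self : modℕ (h * diffMod M y (modℕ y M)) M ≡ diffMod M x (modℕ x M)
      self = trans (cong (λ d → (h * d) % M) (diffMod-self y<M)) (trans (cong (_% M) (*-zeroʳ h)) (sym (diffMod-self x<M)))
      inner≥1 : 1 ≤ Σ< M (λ b → χB b * I x b)
      inner≥1 = ≤-trans (*-mono-≤ χy (≤-reflexive (sym (𝟙-yes (_ ≟ _) self)))) (term≤Σ< M y (λ b → χB b * I x b) y<M)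
    unit≡unit*pairs : ∀ h → h < M → isUnit h ≡ isUnit h * pairs M x y h
    unit≡unit*pairs = Σ<-tight M {f = isUnit} {g = λ h → isUnit h * pairs M x y h} (λ h _ → ≤-unit h)
      (sym (trans (sym (boxSum≡Σ<pairs ∣-refl (s≤s z≤n) x y)) box≡φ))
      where
      ≤-unit : ∀ h → isUnit h ≤ isUnit h * pairs M x y h
      ≤-unit h with gcd h M ≟ 1
      ... | yes _ = ≤-trans (pairs≥1 h) (≤-reflexive (sym (*-identityˡ _)))
      ... | no _  = z≤n
    unit-m : isUnit m ≡ 1
    unit-m = 𝟙-yes (gcd m M ≟ 1) gcd[m,M]≡1
    s≡1 : s ≡ 1 [mod M ]
    s≡1 = subst (λ t → m * t ≡ 1 [mod M ]) (*-identityʳ m) (m*[m*z]≡z 1)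
    c′≡c : c′ ≡ c [mod M ]
    c′≡c = ≡mod-cancelʳ-+ (x + y) (≡mod-trans c′+xy≡0 (≡mod-sym c+xy≡0))
      where
      c′+xy≡0 : c′ + (x + y) ≡ 0 [mod M ]
      c′+xy≡0 = ≡mod-trans (≡mod-+ (≡mod-refl {a = c′}) (≡mod-+ (≡mod-refl {a = x})
          (≡mod-sym (subst (s * y ≡_[mod M ]) (*-identityˡ y) (≡mod-*ʳ y s≡1)))))
        (subst (_≡ 0 [mod M ]) (+-comm (x + s * y) c′) (z+m*z≡0 (x + s * y)))
      c+xy≡0 : c + (x + y) ≡ 0 [mod M ]
      c+xy≡0 = subst (_≡ 0 [mod M ]) (+-comm (x + y) c) (sum-vanishes x y c hit)

  directSum⇒boxProduct : DirectSum A B → ∀ {N} → N ∣ M → (x y : Fin M) →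
    boxProduct N (boxOf A N x) (boxOf B N y) ≡ frac M N
  directSum⇒boxProduct A⊕B {N} (divides K M≡KN) x y = begin
    boxProduct N (boxOf A N x) (boxOf B N y)  ≡⟨ boxProduct≡frac (divides K M≡KN) x y ⟩
    frac (boxSum N (toℕ x) (toℕ y)) (totient M)
      ≡⟨ cong (λ z → frac z (totient M)) (boxSum≡totient*K (directSum⇒tiles A⊕B) {N} {K} NK≡M (toℕ x) (toℕ y)) ⟩
    frac (totient M * K) (totient M)           ≡⟨ frac-cross (totient M * K) M (totient M) N φK*N≡M*φ 1≤totient 1≤N ⟩
    frac M N                                   ∎
    where
    open ≡-Reasoning
    NK≡M : N * K ≡ M
    NK≡M = trans (*-comm N K) (sym M≡KN)
    1≤N : 1 ≤ N
    1≤N = n≢0⇒n>0 λ { refl → 1+n≢0 (trans M≡KN (*-zeroʳ K)) }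
    φK*N≡M*φ : totient M * K * N ≡ M * totient M
    φK*N≡M*φ = trans (*-assoc (totient M) K N) (trans (cong (totient M *_) (trans (*-comm K N) NK≡M)) (*-comm (totient M) M))

  directSum⇒boxProducts : DirectSum A B → ∀ {N} → N ∣ M → (x y : Fin M) →
    (boxProduct N (boxOf A N x) (boxOf B N y) ≡ frac (∣ A ∣ * ∣ B ∣) N)
    × (boxProduct N (boxOf A N x) (boxOf B N y) ≡ frac M N)
    × (boxProduct M (boxOf A M x) (boxOf B M y) ≡ 1ℚ)
  directSum⇒boxProducts A⊕B {N} N∣M x y =
    trans box≡M/N (cong (λ z → frac z N) (sym |A||B|≡M)) , box≡M/N ,
    trans (directSum⇒boxProduct A⊕B ∣-refl x y) (frac-cross M 1 M 1 (*-comm M 1) (s≤s z≤n) (s≤s z≤n))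
    where
    box≡M/N : boxProduct N (boxOf A N x) (boxOf B N y) ≡ frac M N
    box≡M/N = directSum⇒boxProduct A⊕B N∣M x y
    |A||B|≡M : ∣ A ∣ * ∣ B ∣ ≡ M
    |A||B|≡M = trans (cong₂ _*_ (∣∣≡Σ<χ A) (∣∣≡Σ<χ B)) (tiles⇒|A||B|≡M 1 (directSum⇒tiles A⊕B))

  box≡1⇒directSum : ∣ A ∣ * ∣ B ∣ ≡ M →
    (∀ a b → a ∈ A → b ∈ B → boxProduct M (boxOf A M a) (boxOf B M b) ≡ 1ℚ) → DirectSum A B
  box≡1⇒directSum |A||B|≡M box≡1 =
    tiles⇒directSum (reps≤1⇒tiles 1 (trans (sym (cong₂ _*_ (∣∣≡Σ<χ A) (∣∣≡Σ<χ B))) |A||B|≡M) reps≤1)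
    where
    boxSum≡φ : ∀ {x y} (x<M : x < M) (y<M : y < M) → 1 ≤ χA x → 1 ≤ χB y → boxSum M x y ≡ totient M
    boxSum≡φ {x} {y} x<M y<M χx χy = subst₂ (λ x y → boxSum M x y ≡ totient M) (toℕ-fromℕ< x<M) (toℕ-fromℕ< y<M)
      (trans (sym (*-identityʳ (boxSum M (toℕ a) (toℕ b)))) (trans (frac-injective (boxSum M (toℕ a) (toℕ b)) 1 (totient M) 1
        (trans (sym (boxProduct≡frac ∣-refl a b)) (box≡1 a b (χ≥1⇒∈ x x<M χx) (χ≥1⇒∈ y y<M χy))) 1≤totient (s≤s z≤n))
        (+-identityʳ _)))
      where
      a = fromℕ< x<M
      b = fromℕ< y<M
    reps≤1 : ∀ c → c < M → reps 1 c ≤ 1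
    reps≤1 c _ with reps 1 c in e
    ... | 0     = z≤n
    ... | suc r with reps-witness 1 c (subst (1 ≤_) (sym e) (s≤s z≤n))
    ...   | x , y , x<M , y<M , χx , χy , hit =
      subst (_≤ 1) (trans (sym (box≡1⇒unique-sum x<M y<M χx χy (boxSum≡φ x<M y<M χx χy) c hit)) e) ≤-refl

prodFin-nonZero : ∀ {K} (f : Fin K → ℕ) → (∀ i → NonZero (f i)) → NonZero (prodFin f)
prodFin-nonZero {zero}  f _  = _
prodFin-nonZero {suc K} f nz =
  m*n≢0 (f Fin.zero) (prodFin (λ i → f (Fin.suc i)))
    {{nz Fin.zero}} {{prodFin-nonZero (λ i → f (Fin.suc i)) (λ i → nz (Fin.suc i))}}

modulus-nonZero : ∀ {K} (p n : Fin K → ℕ) → (∀ i → Prime (p i)) → NonZero (modulus p n)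
modulus-nonZero p n p-prime =
  prodFin-nonZero (λ i → p i ^ n i) (λ i → m^n≢0 (p i) (n i) {{prime⇒nonZero (p-prime i)}})

mainTheorem3 : (K : ℕ) (p n : Fin K → ℕ) →
    (∀ i → Prime (p i)) → (∀ i j → p i ≡ p j → i ≡ j) → (∀ i → 1 ≤ n i) →
    ((A B : Subset (modulus p n)) → DirectSum A B →
       (N : ℕ) → N ∣ modulus p n → (x y : Fin (modulus p n)) →
         (boxProduct N (boxOf A N x) (boxOf B N y) ≡ frac (∣ A ∣ * ∣ B ∣) N)
         × (boxProduct N (boxOf A N x) (boxOf B N y) ≡ frac (modulus p n) N)
         × (boxProduct (modulus p n) (boxOf A (modulus p n) x) (boxOf B (modulus p n) y) ≡ 1ℚ))
    × ((A B : Subset (modulus p n)) → ∣ A ∣ * ∣ B ∣ ≡ modulus p n →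
         (∀ a b → a ∈ A → b ∈ B →
            boxProduct (modulus p n) (boxOf A (modulus p n) a) (boxOf B (modulus p n) b) ≡ 1ℚ) →
         DirectSum A B)
mainTheorem3 K p n p-prime _ _ with modulus p n | modulus-nonZero p n p-prime
... | zero  | M≢0 = ⊥-elim (≢-nonZero⁻¹ 0 {{M≢0}} refl)
... | suc m | _   = (λ A B A⊕B N → BoxProduct.directSum⇒boxProducts m A B A⊕B {N}) , BoxProduct.box≡1⇒directSum m
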